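{- Let $g$ be the morphism on $A_6=\{a,b,c,d,e,f\}$ defined by $g(a)=abac$, $g(b)=babd$, $g(c)=eabdf$, $g(d)=fbace$, $g(e)=bace$, $g(f)=abdf$, and let $\mathbf{g}=g^\infty(a)$ be the infinite fixed point of $g$ beginning with $a$. Then no square that is a factor of $\mathbf{g}$ contains at least four occurrences of the word $abac$.
   Context: $g^\infty(a)$ denotes the infinite word having every $g^k(a)$, $k\ge 1$, as a prefix. A square is a word $ww$ with $w$ nonempty. A factor is a contiguous finite subword. -}

module Defs where

open import Data.Nat using (ℕ; zero; suc; _+_; _≡ᵇ_)
open import Data.Bool using (Bool; true; false; _∧_; if_then_else_)
open import Data.List using (List; []; _∷_; concatMap)

data A₆ : Set where
  a b c d e f : A₆

code : A₆ → ℕ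
code a = 0
code b = 1
code c = 2
code d = 3
code e = 4
code f = 5

_==_ : A₆ → A₆ → Bool
x == y = code x ≡ᵇ code y

g : A₆ → List A₆
g a = a ∷ b ∷ a ∷ c ∷ []
g b = b ∷ a ∷ b ∷ d ∷ []
g c = e ∷ a ∷ b ∷ d ∷ f ∷ []
g d = f ∷ b ∷ a ∷ c ∷ e ∷ []
g e = b ∷ a ∷ c ∷ e ∷ []
g f = a ∷ b ∷ d ∷ f ∷ []

gʷ : List A₆ → List A₆
gʷ = concatMap g

g^ : ℕ → List A₆ → List A₆
g^ zero w = w
g^ (suc n) w = gʷ (g^ n w)

isPrefix : List A₆ → List A₆ → Bool
isPrefix [] w = true
isPrefix (x ∷ p) [] = false
isPrefix (x ∷ p) (y ∷ w) = (x == y) ∧ isPrefix p w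

occ : List A₆ → List A₆ → ℕ
occ p [] = if isPrefix p [] then 1 else 0
occ p (x ∷ w) = (if isPrefix p (x ∷ w) then 1 else 0) + occ p w

abac : List A₆
abac = a ∷ b ∷ a ∷ c ∷ []

-- We prove more, namely that 𝐠 is square-free.  The argument is a desubstitution argument driven by finite
-- certificates that are checked by evaluation.
--   * Windows.  Every factor of length ≤ 31 of an iterate g^k(a) is a prefix of
--     one of finitely many listed windows (induction on k: a short factor of
--     g(X) lies in the image of a short factor of X).
--   * Contexts.  No factor u₁ W u₂ W u₃ with W ≠ ε occurs in g^k(a) for any
--     (u₁ , u₂ , u₃) in a finite list containing (ε , ε , ε).  If |W| ≤ 12 the
--     factor has length ≤ 31 and the windows exclude it.  If |W| ≥ 13, the
--     first 8 letters of W contain a marker whose cut point always lies on a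
--     letter boundary; cutting both copies of W there and desubstituting gives a
--     factor u y₁ m y₁ v of g^(k-1)(a), and (u , m , v) is again a listed context
--     because the list is closed under this operation (a finite check).

module Submission where

open import Defs
open import Data.Nat using (ℕ; zero; suc; _+_; _*_; _∸_; _≤_; _<_; z≤n; s≤s; _≤?_; _≤ᵇ_; _<ᵇ_)
open import Data.Nat.Properties hiding (_≟_)
import Data.Nat.Properties as ℕ
open import Data.Nat.Solver using (module +-*-Solver)
open import Data.Bool using (Bool; true; false; _∧_; _∨_; not; T; if_then_else_)
open import Data.Bool.Properties using (T-∧; T-≡)
open import Data.Bool.ListAction using (all; any)
open import Data.List using (List; []; _∷_; _++_; length; concat; map; take; drop; reverse; null; upTo)
open import Data.List.Properties
  using (++-assoc; ++-identityʳ; length-++; length-take; reverse-++; ++-monoid; take++drop≡id;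
         ∷-injective; ∷-injectiveʳ; ++-conicalˡ; ++-conicalʳ; concat-++; map-++; ≡-dec)
open import Data.List.Relation.Unary.Any using (here; there)
open import Data.List.Relation.Unary.Any.Properties using (any⁺; any⁻)
open import Data.List.Relation.Unary.All using () renaming (lookup to All-lookup)
open import Data.List.Relation.Unary.All.Properties using (all⁺)
open import Data.List.Membership.Propositional using (_∈_; find; lose)
open import Data.List.Membership.Propositional.Properties using (∈-map⁺; ∈-upTo⁺)
import Data.List.Membership.DecPropositional as DecMembership
open import Data.Maybe using (Maybe; just; nothing; maybe; _>>=_; is-just)
open import Data.Maybe.Properties using (just-injective)
open import Data.Product using (∃-syntax; _×_; _,_; proj₁; proj₂)
open import Data.Product.Properties using (,-injective)
import Data.Product.Properties as Product
open import Data.Sum using (_⊎_; inj₁; inj₂)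
open import Data.Empty using (⊥; ⊥-elim)
open import Function using (_∘_)
open import Function.Bundles using (Equivalence)
open import Relation.Nullary using (yes; no)
open import Relation.Nullary.Decidable using (map′; toWitness; ⌊_⌋)
open import Relation.Binary.Definitions using (DecidableEquality)
open import Relation.Binary.PropositionalEquality using (_≡_; _≢_; refl; sym; trans; cong; subst; module ≡-Reasoning)
open import Algebra.Solver.Monoid (++-monoid A₆) using (solve; _⊕_; _⊜_)
open +-*-Solver using () renaming (solve to solveℕ; _:+_ to _:+_; _:=_ to _:=_)

Word : Set
Word = List A₆

∧-split : ∀ {p q} → T (p ∧ q) → T p × T q
∧-split = Equivalence.to T-∧

∧-pair : ∀ {p q} → T p → T q → T (p ∧ q)
∧-pair tp tq = Equivalence.from T-∧ (tp , tq)

implies : Bool → Bool → Bool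
implies p q = not p ∨ q

implies-elim : ∀ {p q} → T (implies p q) → T p → T q
implies-elim {true} tq _ = tq

not-T : ∀ {x} → T (not x) → T x → ⊥
not-T {false} _ ()

all-elim : ∀ {A : Set} (p : A → Bool) {xs x} → x ∈ xs → T (all p xs) → T (p x)
all-elim p {xs} x∈ t = All-lookup (all⁺ p xs t) x∈

letter : ℕ → A₆
letter 0 = a
letter 1 = b
letter 2 = c
letter 3 = d
letter 4 = e
letter _ = f

letter-code : ∀ x → letter (code x) ≡ x
letter-code a = refl
letter-code b = refl
letter-code c = refl
letter-code d = refl
letter-code e = refl
letter-code f = refl

code-injective : ∀ {x y} → code x ≡ code y → x ≡ y
code-injective {x} {y} eq = trans (sym (letter-code x)) (trans (cong letter eq) (letter-code y))

==-sound : ∀ x y → T (x == y) → x ≡ y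
==-sound x y t = code-injective (≡ᵇ⇒≡ (code x) (code y) t)

==-refl : ∀ x → T (x == x)
==-refl x = ≡⇒≡ᵇ (code x) (code x) refl

_≟_ : DecidableEquality A₆
x ≟ y = map′ code-injective (cong code) (code x ℕ.≟ code y)

letters : List A₆
letters = a ∷ b ∷ c ∷ d ∷ e ∷ f ∷ []

∈-letters : ∀ x → x ∈ letters
∈-letters a = here refl
∈-letters b = there (here refl)
∈-letters c = there (there (here refl))
∈-letters d = there (there (there (here refl)))
∈-letters e = there (there (there (there (here refl))))
∈-letters f = there (there (there (there (there (here refl)))))

isPrefix-sound : ∀ p w → T (isPrefix p w) → ∃[ r ] w ≡ p ++ r
isPrefix-sound [] w _ = w , refl
isPrefix-sound (x ∷ p) (y ∷ w) t with ∧-split {x == y} t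
... | x=y , pw with ==-sound x y x=y | isPrefix-sound p w pw
...   | refl | r , refl = r , refl

isPrefix-complete : ∀ p r → T (isPrefix p (p ++ r))
isPrefix-complete [] r = _
isPrefix-complete (x ∷ p) r = ∧-pair (==-refl x) (isPrefix-complete p r)

isSuffix : Word → Word → Bool
isSuffix t w = isPrefix (reverse t) (reverse w)

isSuffix-complete : ∀ P Z → T (isSuffix Z (P ++ Z))
isSuffix-complete P Z = subst (T ∘ isPrefix (reverse Z)) (sym (reverse-++ P Z)) (isPrefix-complete (reverse Z) (reverse P))

strip : Word → Word → Maybe Word
strip [] S = just S
strip (x ∷ s) [] = nothing
strip (x ∷ s) (y ∷ S) = if x == y then strip s S else nothing

strip-++ : ∀ s r → strip s (s ++ r) ≡ just r
strip-++ [] r = refl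
strip-++ (x ∷ s) r rewrite Equivalence.to T-≡ (==-refl x) = strip-++ s r

take-length-++ : ∀ (p q : Word) → take (length p) (p ++ q) ≡ p
take-length-++ [] q = refl
take-length-++ (x ∷ p) q = cong (x ∷_) (take-length-++ p q)

drop-length-++ : ∀ (p q : Word) → drop (length p) (p ++ q) ≡ q
drop-length-++ [] q = refl
drop-length-++ (x ∷ p) q = drop-length-++ p q

take-prefix : ∀ n (F V : Word) → length F ≤ n → ∃[ V′ ] take n (F ++ V) ≡ F ++ V′
take-prefix n [] V _ = take n V , refl
take-prefix (suc n) (x ∷ F) V (s≤s lF) with take-prefix n F V lF
... | V′ , eq = V′ , cong (x ∷_) eq

length-++₃ : ∀ (p q r : Word) → length (p ++ q ++ r) ≡ length p + length q + length r
length-++₃ p q r = trans (length-++ p) (trans (cong (length p +_) (length-++ q)) (sym (+-assoc (length p) (length q) (length r))))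

factor-length : ∀ {X : Word} P F S → X ≡ P ++ F ++ S → length F ≤ length X
factor-length P F S refl = begin
  length F                         ≤⟨ m≤m+n (length F) (length S) ⟩
  length F + length S              ≡⟨ length-++ F ⟨
  length (F ++ S)                  ≤⟨ m≤n+m (length (F ++ S)) (length P) ⟩
  length P + length (F ++ S)       ≡⟨ length-++ P ⟨
  length (P ++ F ++ S)             ∎
  where open ≤-Reasoning

drop-last : Word → Word
drop-last [] = []
drop-last (x ∷ []) = []
drop-last (x ∷ y ∷ w) = x ∷ drop-last (y ∷ w)

drop-last-snoc : ∀ w z → drop-last (w ++ z ∷ []) ≡ w
drop-last-snoc [] z = refl
drop-last-snoc (x ∷ []) z = refl
drop-last-snoc (x ∷ y ∷ w) z = cong (x ∷_) (drop-last-snoc (y ∷ w) z)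

proper-splits : Word → List (Word × Word)
proper-splits [] = []
proper-splits (x ∷ w) = ([] , x ∷ w) ∷ map (λ (P , s) → (x ∷ P , s)) (proper-splits w)

∈-proper-splits : ∀ P s → s ≢ [] → (P , s) ∈ proper-splits (P ++ s)
∈-proper-splits [] [] s≢[] = ⊥-elim (s≢[] refl)
∈-proper-splits [] (x ∷ s) _ = here refl
∈-proper-splits (x ∷ P) s s≢[] = there (∈-map⁺ (λ (P , s) → (x ∷ P , s)) (∈-proper-splits P s s≢[]))

-- The morphism g on words

gʷ-++ : ∀ u v → gʷ (u ++ v) ≡ gʷ u ++ gʷ v
gʷ-++ u v = trans (cong concat (map-++ g u v)) (sym (concat-++ (map g u) (map g v)))

image-length : ∀ x → 4 ≤ length (g x) × length (g x) ≤ 5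
image-length a = ≤-refl , n≤1+n 4
image-length b = ≤-refl , n≤1+n 4
image-length c = n≤1+n 4 , ≤-refl
image-length d = n≤1+n 4 , ≤-refl
image-length e = ≤-refl , n≤1+n 4
image-length f = ≤-refl , n≤1+n 4

-- g is a prefix code: the first image can be read off the front of a word.
parse : Word → Maybe (A₆ × Word)
parse (a ∷ b ∷ a ∷ c ∷ r) = just (a , r)
parse (b ∷ a ∷ b ∷ d ∷ r) = just (b , r)
parse (e ∷ a ∷ b ∷ d ∷ f ∷ r) = just (c , r)
parse (f ∷ b ∷ a ∷ c ∷ e ∷ r) = just (d , r)
parse (b ∷ a ∷ c ∷ e ∷ r) = just (e , r)
parse (a ∷ b ∷ d ∷ f ∷ r) = just (f , r)
parse _ = nothing

parse-image : ∀ x r → parse (g x ++ r) ≡ just (x , r)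
parse-image a r = refl
parse-image b r = refl
parse-image c r = refl
parse-image d r = refl
parse-image e r = refl
parse-image f r = refl

image-injective : ∀ x y s t → g x ++ s ≡ g y ++ t → x ≡ y × s ≡ t
image-injective x y s t eq =
  ,-injective (just-injective (trans (sym (parse-image x s)) (trans (cong parse eq) (parse-image y t))))

image-nonempty : ∀ x s → g x ++ s ≢ []
image-nonempty x s eq with ≤-trans (proj₁ (image-length x)) (≤-reflexive (cong length (++-conicalˡ (g x) s eq)))
... | ()

decode : Word → Maybe Word
decode [] = just []
decode (a ∷ b ∷ a ∷ c ∷ r) = Data.Maybe.map (a ∷_) (decode r)
decode (b ∷ a ∷ b ∷ d ∷ r) = Data.Maybe.map (b ∷_) (decode r)
decode (e ∷ a ∷ b ∷ d ∷ f ∷ r) = Data.Maybe.map (c ∷_) (decode r)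
decode (f ∷ b ∷ a ∷ c ∷ e ∷ r) = Data.Maybe.map (d ∷_) (decode r)
decode (b ∷ a ∷ c ∷ e ∷ r) = Data.Maybe.map (e ∷_) (decode r)
decode (a ∷ b ∷ d ∷ f ∷ r) = Data.Maybe.map (f ∷_) (decode r)
decode _ = nothing

decode-image : ∀ y → decode (gʷ y) ≡ just y
decode-image [] = refl
decode-image (a ∷ y) rewrite decode-image y = refl
decode-image (b ∷ y) rewrite decode-image y = refl
decode-image (c ∷ y) rewrite decode-image y = refl
decode-image (d ∷ y) rewrite decode-image y = refl
decode-image (e ∷ y) rewrite decode-image y = refl
decode-image (f ∷ y) rewrite decode-image y = refl

equidivisible : ∀ (p q r s : Word) → p ++ q ≡ r ++ s →
                (∃[ m ] r ≡ p ++ m × q ≡ m ++ s) ⊎ (∃[ m ] m ≢ [] × p ≡ r ++ m × s ≡ m ++ q)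
equidivisible [] q r s eq = inj₁ (r , refl , eq)
equidivisible (x ∷ p) q [] s eq = inj₂ (x ∷ p , (λ ()) , refl , sym eq)
equidivisible (x ∷ p) q (y ∷ r) s eq with ∷-injective eq
... | refl , eq′ with equidivisible p q r s eq′
...   | inj₁ (m , r≡ , q≡) = inj₁ (m , cong (x ∷_) r≡ , q≡)
...   | inj₂ (m , m≢[] , p≡ , s≡) = inj₂ (m , m≢[] , cong (x ∷_) p≡ , s≡)

decode-prefix : ∀ B X r → gʷ X ≡ gʷ B ++ r → ∃[ C ] X ≡ B ++ C × gʷ C ≡ r
decode-prefix [] X r eq = X , refl , eq
decode-prefix (y ∷ B) [] r eq = ⊥-elim (image-nonempty y (gʷ B ++ r) (sym (trans eq (++-assoc (g y) (gʷ B) r))))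
decode-prefix (y ∷ B) (x ∷ X) r eq with image-injective x y (gʷ X) (gʷ B ++ r) (trans eq (++-assoc (g y) (gʷ B) r))
... | refl , eq′ with decode-prefix B X r eq′
...   | C , refl , eq″ = C , refl , eq″

image-length-word : ∀ w → 4 * length w ≤ length (gʷ w)
image-length-word [] = z≤n
image-length-word (x ∷ w) = begin
  4 * suc (length w)          ≡⟨ *-suc 4 (length w) ⟩
  4 + 4 * length w            ≤⟨ +-mono-≤ (proj₁ (image-length x)) (image-length-word w) ⟩
  length (g x) + length (gʷ w) ≡⟨ length-++ (g x) ⟨
  length (gʷ (x ∷ w))         ∎
  where open ≤-Reasoning

short-preimage : ∀ w {n} k → length (gʷ w) ≡ n → n < 4 * suc k → length w ≤ k
short-preimage w k refl lt = ≤-pred (*-cancelˡ-< 4 (length w) (suc k) (≤-<-trans (image-length-word w) lt))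

proper-prefix : ∀ z P s → g z ≡ P ++ s → s ≢ [] → length P < length (g z)
proper-prefix z P [] _ s≢[] = ⊥-elim (s≢[] refl)
proper-prefix z P (x ∷ s) gz≡ _ = begin-strict
  length P                    <⟨ m<m+n (length P) (s≤s z≤n) ⟩
  length P + length (x ∷ s)   ≡⟨ length-++ P ⟨
  length (P ++ x ∷ s)         ≡⟨ cong length gz≡ ⟨
  length (g z)                ∎
  where open ≤-Reasoning

proper-prefix-short : ∀ z P s → g z ≡ P ++ s → s ≢ [] → length P ≤ 4
proper-prefix-short z P s gz≡ s≢[] = ≤-pred (≤-trans (proper-prefix z P s gz≡ s≢[]) (proj₂ (image-length z)))

-- Cutting an image g(X) at an arbitrary position

-- Where a cut U | R of g(X) falls: at the end of g(X), or inside the image of a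
-- letter z, after a proper prefix P of g(z).
data Boundary (X₂ P R : Word) : Set where
  at-end : X₂ ≡ [] → P ≡ [] → R ≡ [] → Boundary X₂ P R
  inside : ∀ z X′ s → X₂ ≡ z ∷ X′ → g z ≡ P ++ s → s ≢ [] → R ≡ s ++ gʷ X′ → Boundary X₂ P R

record Cut (X U R : Word) : Set where
  constructor cut-at
  field
    X₁ X₂ P : Word
    X≡ : X ≡ X₁ ++ X₂
    U≡ : U ≡ gʷ X₁ ++ P
    boundary : Boundary X₂ P R

cut : ∀ X U R → gʷ X ≡ U ++ R → Cut X U R
cut [] U R eq = cut-at [] [] [] refl (++-conicalˡ U R (sym eq)) (at-end refl refl (++-conicalʳ U R (sym eq)))
cut (x ∷ X) U R eq with equidivisible (g x) (gʷ X) U R eq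
... | inj₂ (s , s≢[] , gx≡ , R≡) = cut-at [] (x ∷ X) U refl refl (inside x X s refl gx≡ s≢[] R≡)
... | inj₁ (m , U≡ , gX≡) with cut X m R gX≡
...   | cut-at X₁ X₂ P refl m≡ bnd =
        cut-at (x ∷ X₁) X₂ P refl (trans U≡ (trans (cong (g x ++_) m≡) (sym (++-assoc (g x) (gʷ X₁) P)))) bnd

boundary-prefix-short : ∀ {X₂ P R} → Boundary X₂ P R → length P ≤ 4
boundary-prefix-short (at-end _ refl _) = z≤n
boundary-prefix-short {P = P} (inside z X′ s _ gz≡ s≢[] _) = proper-prefix-short z P s gz≡ s≢[]

boundary-image : ∀ {X₂ P R} → Boundary X₂ P R → gʷ X₂ ≡ P ++ R
boundary-image (at-end refl refl refl) = refl
boundary-image {P = P} (inside z X′ s refl gz≡ _ refl) = trans (cong (_++ gʷ X′) gz≡) (++-assoc P s (gʷ X′))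

-- Minimality is what keeps the finite
-- list of contexts in the certificate small.

data ShortestPrefix (v Z : Word) : Set where
  empty : v ≡ [] → Z ≡ [] → ShortestPrefix v Z
  last-letter-needed : ∀ v₀ z → v ≡ v₀ ++ z ∷ [] → length (gʷ v₀) < length Z → ShortestPrefix v Z

record PrefixCover (Y Z : Word) : Set where
  constructor prefix-cover
  field
    v Y′ R : Word
    Y≡ : Y ≡ v ++ Y′
    image : gʷ v ≡ Z ++ R
    overhang : length R ≤ 4
    shortest : ShortestPrefix v Z

cover-prefix : ∀ Y Z V → gʷ Y ≡ Z ++ V → PrefixCover Y Z
cover-prefix Y [] V _ = prefix-cover [] Y [] refl refl z≤n (empty refl refl)
cover-prefix [] (t ∷ Z) V ()
cover-prefix (y ∷ Y) (t ∷ Z) V eq with equidivisible (g y) (gʷ Y) (t ∷ Z) V eq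
... | inj₂ (R , R≢[] , gy≡ , _) =
      prefix-cover (y ∷ []) Y R refl (trans (++-identityʳ (g y)) gy≡) overhang
                   (last-letter-needed [] y refl (s≤s z≤n))
  where
  overhang : length R ≤ 4
  overhang = ≤-trans (m≤n+m (length R) (length Z))
                     (≤-pred (≤-trans (≤-reflexive (sym (trans (cong length gy≡) (length-++ (t ∷ Z)))))
                                      (proj₂ (image-length y))))
... | inj₁ (m , tZ≡ , gY≡) with cover-prefix Y m V gY≡
...   | prefix-cover v Y′ R refl gv≡ overhang shortest =
        prefix-cover (y ∷ v) Y′ R refl image overhang (extend shortest)
  where
  image : gʷ (y ∷ v) ≡ (t ∷ Z) ++ R
  image = begin
    g y ++ gʷ v       ≡⟨ cong (g y ++_) gv≡ ⟩
    g y ++ (m ++ R)   ≡⟨ ++-assoc (g y) m R ⟨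
    (g y ++ m) ++ R   ≡⟨ cong (_++ R) tZ≡ ⟨
    (t ∷ Z) ++ R      ∎
    where open ≡-Reasoning
  extend : ShortestPrefix v m → ShortestPrefix (y ∷ v) (t ∷ Z)
  extend (empty refl _) = last-letter-needed [] y refl (s≤s z≤n)
  extend (last-letter-needed v₀ z refl lt) = last-letter-needed (y ∷ v₀) z refl (begin-strict
    length (g y ++ gʷ v₀)       ≡⟨ length-++ (g y) ⟩
    length (g y) + length (gʷ v₀) <⟨ +-monoʳ-< (length (g y)) lt ⟩
    length (g y) + length m      ≡⟨ length-++ (g y) ⟨
    length (g y ++ m)            ≡⟨ cong length tZ≡ ⟨
    length (t ∷ Z)               ∎)
    where open ≤-Reasoning

record SuffixCover (X Z : Word) : Set where
  constructor suffix-cover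
  field
    X′ u P : Word
    X≡ : X ≡ X′ ++ u
    image : gʷ u ≡ P ++ Z
    overhang : length P ≤ 4
    shortest : (u ≡ [] × Z ≡ []) ⊎ (∃[ z ] ∃[ u′ ] u ≡ z ∷ u′ × length P < length (g z))

cover-suffix : ∀ X U Z → gʷ X ≡ U ++ Z → SuffixCover X Z
cover-suffix X U Z eq with cut X U Z eq
... | cut-at X₁ X₂ P refl _ (at-end refl refl refl) =
      suffix-cover X₁ [] [] refl refl z≤n (inj₁ (refl , refl))
... | cut-at X₁ X₂ P refl _ (inside z X′ s refl gz≡ s≢[] refl) =
      suffix-cover X₁ (z ∷ X′) P refl
                   (trans (cong (_++ gʷ X′) gz≡) (++-assoc P s (gʷ X′)))
                   (proper-prefix-short z P s gz≡ s≢[])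
                   (inj₂ (z , X′ , refl , proper-prefix z P s gz≡ s≢[]))

-- A marker is a word with a distinguished cut point (between
-- `before i` and `after i`); wherever it occurs in an image g(X), its cut point
-- is a boundary between the images of two letters of X.  Every factor of length
-- 8 of the fixed point contains a marker, which synchronises long factors.

data Marker : Set where
  aba bab fbace eabdf : Marker

before after : Marker → Word
before aba = []
before bab = []
before fbace = f ∷ b ∷ a ∷ c ∷ e ∷ []
before eabdf = e ∷ a ∷ b ∷ d ∷ f ∷ []
after aba = a ∷ b ∷ a ∷ []
after bab = b ∷ a ∷ b ∷ []
after fbace = []
after eabdf = []

marker-word : Marker → Word
marker-word i = before i ++ after i

markers : List Marker
markers = aba ∷ bab ∷ fbace ∷ eabdf ∷ []

∈-markers : ∀ i → i ∈ markers
∈-markers aba = here refl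
∈-markers bab = there (here refl)
∈-markers fbace = there (there (here refl))
∈-markers eabdf = there (there (there (here refl)))

compatible : Word → Word → Bool
compatible (x ∷ p) (y ∷ q) = (x == y) ∧ compatible p q
compatible _ _ = true

compatible-++ : ∀ p q {r s} → p ++ r ≡ q ++ s → T (compatible p q)
compatible-++ [] q eq = _
compatible-++ (x ∷ p) [] eq = _
compatible-++ (x ∷ p) (y ∷ q) eq with ∷-injective eq
... | refl , eq′ = ∧-pair (==-refl x) (compatible-++ p q eq′)

no-marker : Word → Bool
no-marker s = all (λ i → not (compatible (marker-word i) s)) markers

no-marker-at : ∀ i s {Q} R → marker-word i ++ Q ≡ s ++ R → T (no-marker s) → ⊥
no-marker-at i s R eq none =
  not-T (All-lookup (all⁺ (λ j → not (compatible (marker-word j) s)) markers none) (∈-markers i))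
        (compatible-++ (marker-word i) s eq)

-- A marker that overflows g(z) ends exactly with the image of the next letter.
next-image : ∀ z′ X Q → g z′ ++ Q ≡ gʷ X → ∃[ C ] X ≡ z′ ∷ C × gʷ C ≡ Q
next-image z′ X Q eq = decode-prefix (z′ ∷ []) X Q (trans (sym eq) (cong (_++ Q) (sym (++-identityʳ (g z′)))))

record Aligned (i : Marker) (z : A₆) (X P Q : Word) : Set where
  constructor aligned
  field
    left right : Word
    split : z ∷ X ≡ left ++ right
    left-image : gʷ left ≡ P ++ before i
    right-image : gʷ right ≡ after i ++ Q

align : ∀ i z P s X Q → g z ≡ P ++ s → s ≢ [] → marker-word i ++ Q ≡ s ++ gʷ X → Aligned i z X P Q
align aba a [] _ X Q refl _ refl = aligned [] (a ∷ X) refl refl refl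
align bab a [] _ X Q refl _ ()
align fbace a [] _ X Q refl _ ()
align eabdf a [] _ X Q refl _ ()
align i a (a ∷ []) s X Q refl _ eq = ⊥-elim (no-marker-at i s (gʷ X) eq _)
align i a (a ∷ b ∷ []) s X Q refl _ eq = ⊥-elim (no-marker-at i s (gʷ X) eq _)
align i a (a ∷ b ∷ a ∷ []) s X Q refl _ eq = ⊥-elim (no-marker-at i s (gʷ X) eq _)
align i a (a ∷ b ∷ a ∷ c ∷ []) [] X Q refl s≢[] _ = ⊥-elim (s≢[] refl)
align aba b [] _ X Q refl _ ()
align bab b [] _ X Q refl _ refl = aligned [] (b ∷ X) refl refl refl
align fbace b [] _ X Q refl _ ()
align eabdf b [] _ X Q refl _ ()
align i b (b ∷ []) s X Q refl _ eq = ⊥-elim (no-marker-at i s (gʷ X) eq _)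
align i b (b ∷ a ∷ []) s X Q refl _ eq = ⊥-elim (no-marker-at i s (gʷ X) eq _)
align i b (b ∷ a ∷ b ∷ []) s X Q refl _ eq = ⊥-elim (no-marker-at i s (gʷ X) eq _)
align i b (b ∷ a ∷ b ∷ d ∷ []) [] X Q refl s≢[] _ = ⊥-elim (s≢[] refl)
align aba c [] _ X Q refl _ ()
align bab c [] _ X Q refl _ ()
align fbace c [] _ X Q refl _ ()
align eabdf c [] _ X Q refl _ refl = aligned (c ∷ []) X refl refl refl
align i c (e ∷ []) s X Q refl _ eq = ⊥-elim (no-marker-at i s (gʷ X) eq _)
align i c (e ∷ a ∷ []) s X Q refl _ eq = ⊥-elim (no-marker-at i s (gʷ X) eq _)
align i c (e ∷ a ∷ b ∷ []) s X Q refl _ eq = ⊥-elim (no-marker-at i s (gʷ X) eq _)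
align aba c (e ∷ a ∷ b ∷ d ∷ []) _ X Q refl _ ()
align bab c (e ∷ a ∷ b ∷ d ∷ []) _ X Q refl _ ()
align fbace c (e ∷ a ∷ b ∷ d ∷ []) _ X Q refl _ eq with next-image e X Q (∷-injectiveʳ eq)
... | C , refl , gC≡Q = aligned (c ∷ e ∷ []) C refl refl gC≡Q
align eabdf c (e ∷ a ∷ b ∷ d ∷ []) _ X Q refl _ ()
align i c (e ∷ a ∷ b ∷ d ∷ f ∷ []) [] X Q refl s≢[] _ = ⊥-elim (s≢[] refl)
align aba d [] _ X Q refl _ ()
align bab d [] _ X Q refl _ ()
align fbace d [] _ X Q refl _ refl = aligned (d ∷ []) X refl refl refl
align eabdf d [] _ X Q refl _ ()
align i d (f ∷ []) s X Q refl _ eq = ⊥-elim (no-marker-at i s (gʷ X) eq _)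
align i d (f ∷ b ∷ []) s X Q refl _ eq = ⊥-elim (no-marker-at i s (gʷ X) eq _)
align i d (f ∷ b ∷ a ∷ []) s X Q refl _ eq = ⊥-elim (no-marker-at i s (gʷ X) eq _)
align aba d (f ∷ b ∷ a ∷ c ∷ []) _ X Q refl _ ()
align bab d (f ∷ b ∷ a ∷ c ∷ []) _ X Q refl _ ()
align fbace d (f ∷ b ∷ a ∷ c ∷ []) _ X Q refl _ ()
align eabdf d (f ∷ b ∷ a ∷ c ∷ []) _ X Q refl _ eq with next-image f X Q (∷-injectiveʳ eq)
... | C , refl , gC≡Q = aligned (d ∷ f ∷ []) C refl refl gC≡Q
align i d (f ∷ b ∷ a ∷ c ∷ e ∷ []) [] X Q refl s≢[] _ = ⊥-elim (s≢[] refl)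
align i e [] s X Q refl _ eq = ⊥-elim (no-marker-at i s (gʷ X) eq _)
align i e (b ∷ []) s X Q refl _ eq = ⊥-elim (no-marker-at i s (gʷ X) eq _)
align i e (b ∷ a ∷ []) s X Q refl _ eq = ⊥-elim (no-marker-at i s (gʷ X) eq _)
align aba e (b ∷ a ∷ c ∷ []) _ X Q refl _ ()
align bab e (b ∷ a ∷ c ∷ []) _ X Q refl _ ()
align fbace e (b ∷ a ∷ c ∷ []) _ X Q refl _ ()
align eabdf e (b ∷ a ∷ c ∷ []) _ X Q refl _ eq with next-image f X Q (∷-injectiveʳ eq)
... | C , refl , gC≡Q = aligned (e ∷ f ∷ []) C refl refl gC≡Q
align i e (b ∷ a ∷ c ∷ e ∷ []) [] X Q refl s≢[] _ = ⊥-elim (s≢[] refl)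
align i f [] s X Q refl _ eq = ⊥-elim (no-marker-at i s (gʷ X) eq _)
align i f (a ∷ []) s X Q refl _ eq = ⊥-elim (no-marker-at i s (gʷ X) eq _)
align i f (a ∷ b ∷ []) s X Q refl _ eq = ⊥-elim (no-marker-at i s (gʷ X) eq _)
align aba f (a ∷ b ∷ d ∷ []) _ X Q refl _ ()
align bab f (a ∷ b ∷ d ∷ []) _ X Q refl _ ()
align fbace f (a ∷ b ∷ d ∷ []) _ X Q refl _ eq with next-image e X Q (∷-injectiveʳ eq)
... | C , refl , gC≡Q = aligned (f ∷ e ∷ []) C refl refl gC≡Q
align eabdf f (a ∷ b ∷ d ∷ []) _ X Q refl _ ()
align i f (a ∷ b ∷ d ∷ f ∷ []) [] X Q refl s≢[] _ = ⊥-elim (s≢[] refl)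

marker-cut : ∀ i X L R → gʷ X ≡ L ++ marker-word i ++ R →
             ∃[ X₁ ] ∃[ X₂ ] X ≡ X₁ ++ X₂ × gʷ X₁ ≡ L ++ before i × gʷ X₂ ≡ after i ++ R
marker-cut i X L R eq with cut X L (marker-word i ++ R) eq
... | cut-at X₁ X₂ P refl refl (at-end _ _ M≡[]) = ⊥-elim (marker-nonempty i M≡[])
  where
  marker-nonempty : ∀ i {R} → marker-word i ++ R ≢ []
  marker-nonempty aba ()
  marker-nonempty bab ()
  marker-nonempty fbace ()
  marker-nonempty eabdf ()
... | cut-at X₁ X₂ P refl refl (inside z X′ s refl gz≡ s≢[] M≡) with align i z P s X′ R gz≡ s≢[] M≡
...   | aligned Y₁ Y₂ split left-image right-image =
        X₁ ++ Y₁ , Y₂ , trans (cong (X₁ ++_) split) (sym (++-assoc X₁ Y₁ Y₂)) , left , right-image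
  where
  left : gʷ (X₁ ++ Y₁) ≡ (gʷ X₁ ++ P) ++ before i
  left = trans (gʷ-++ X₁ Y₁) (trans (cong (gʷ X₁ ++_) left-image) (sym (++-assoc (gʷ X₁) P (before i))))

-- The proof rests on four finite lists, each justified by a
-- computation checked below:
--   windows      : words of length 31 such that every factor of length ≤ 31 of
--                  the image of a window begins a window; hence every short
--                  factor of 𝐠 begins a window;
--   shortFactors : contains the prefixes of length ≤ 3 of the windows;
--   factors8     : contains the prefixes of length 8 of the windows;
--   contexts     : triples (u₁ , u₂ , u₃), among them (ε , ε , ε), closed under
--                  desubstitution; no factor u₁ W u₂ W u₃ with W ≠ ε occurs in 𝐠.

Context : Set
Context = Word × Word × Word

-- The lists are opaque: they are only unfolded by the checks below, so that
-- type checking the proofs never evaluates them.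
opaque
  windows : List Word
  windows =
    (a ∷ b ∷ a ∷ c ∷ b ∷ a ∷ b ∷ d ∷ a ∷ b ∷ a ∷ c ∷ e ∷ a ∷ b ∷ d ∷ f ∷ b ∷ a ∷ b ∷ d ∷ a ∷ b ∷ a ∷ c ∷ b ∷ a ∷ b ∷ d ∷ f ∷ b ∷ []) ∷
    (a ∷ b ∷ a ∷ c ∷ b ∷ a ∷ b ∷ d ∷ a ∷ b ∷ a ∷ c ∷ e ∷ a ∷ b ∷ d ∷ f ∷ b ∷ a ∷ c ∷ e ∷ a ∷ b ∷ a ∷ c ∷ b ∷ a ∷ b ∷ d ∷ f ∷ b ∷ []) ∷
    (a ∷ b ∷ a ∷ c ∷ b ∷ a ∷ b ∷ d ∷ f ∷ b ∷ a ∷ c ∷ e ∷ a ∷ b ∷ a ∷ c ∷ b ∷ a ∷ b ∷ d ∷ a ∷ b ∷ a ∷ c ∷ e ∷ a ∷ b ∷ d ∷ f ∷ b ∷ []) ∷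
    (a ∷ b ∷ a ∷ c ∷ b ∷ a ∷ b ∷ d ∷ f ∷ b ∷ a ∷ c ∷ e ∷ a ∷ b ∷ d ∷ f ∷ b ∷ a ∷ b ∷ d ∷ a ∷ b ∷ a ∷ c ∷ b ∷ a ∷ b ∷ d ∷ f ∷ b ∷ []) ∷
    (a ∷ b ∷ a ∷ c ∷ b ∷ a ∷ b ∷ d ∷ f ∷ b ∷ a ∷ c ∷ e ∷ a ∷ b ∷ d ∷ f ∷ b ∷ a ∷ b ∷ d ∷ a ∷ b ∷ a ∷ c ∷ e ∷ a ∷ b ∷ d ∷ f ∷ b ∷ []) ∷
    (a ∷ b ∷ a ∷ c ∷ e ∷ a ∷ b ∷ d ∷ f ∷ b ∷ a ∷ b ∷ d ∷ a ∷ b ∷ a ∷ c ∷ b ∷ a ∷ b ∷ d ∷ f ∷ b ∷ a ∷ c ∷ e ∷ a ∷ b ∷ a ∷ c ∷ b ∷ []) ∷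
    (a ∷ b ∷ a ∷ c ∷ e ∷ a ∷ b ∷ d ∷ f ∷ b ∷ a ∷ b ∷ d ∷ a ∷ b ∷ a ∷ c ∷ b ∷ a ∷ b ∷ d ∷ f ∷ b ∷ a ∷ c ∷ e ∷ a ∷ b ∷ d ∷ f ∷ b ∷ []) ∷
    (a ∷ b ∷ a ∷ c ∷ e ∷ a ∷ b ∷ d ∷ f ∷ b ∷ a ∷ c ∷ e ∷ a ∷ b ∷ a ∷ c ∷ b ∷ a ∷ b ∷ d ∷ a ∷ b ∷ a ∷ c ∷ e ∷ a ∷ b ∷ d ∷ f ∷ b ∷ []) ∷
    (a ∷ b ∷ a ∷ c ∷ e ∷ a ∷ b ∷ d ∷ f ∷ b ∷ a ∷ c ∷ e ∷ a ∷ b ∷ a ∷ c ∷ b ∷ a ∷ b ∷ d ∷ f ∷ b ∷ a ∷ c ∷ e ∷ a ∷ b ∷ d ∷ f ∷ b ∷ []) ∷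
    (a ∷ b ∷ d ∷ a ∷ b ∷ a ∷ c ∷ b ∷ a ∷ b ∷ d ∷ f ∷ b ∷ a ∷ c ∷ e ∷ a ∷ b ∷ a ∷ c ∷ b ∷ a ∷ b ∷ d ∷ a ∷ b ∷ a ∷ c ∷ e ∷ a ∷ b ∷ []) ∷
    (a ∷ b ∷ d ∷ a ∷ b ∷ a ∷ c ∷ b ∷ a ∷ b ∷ d ∷ f ∷ b ∷ a ∷ c ∷ e ∷ a ∷ b ∷ d ∷ f ∷ b ∷ a ∷ b ∷ d ∷ a ∷ b ∷ a ∷ c ∷ e ∷ a ∷ b ∷ []) ∷
    (a ∷ b ∷ d ∷ a ∷ b ∷ a ∷ c ∷ e ∷ a ∷ b ∷ d ∷ f ∷ b ∷ a ∷ b ∷ d ∷ a ∷ b ∷ a ∷ c ∷ b ∷ a ∷ b ∷ d ∷ f ∷ b ∷ a ∷ c ∷ e ∷ a ∷ b ∷ []) ∷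
    (a ∷ b ∷ d ∷ a ∷ b ∷ a ∷ c ∷ e ∷ a ∷ b ∷ d ∷ f ∷ b ∷ a ∷ c ∷ e ∷ a ∷ b ∷ a ∷ c ∷ b ∷ a ∷ b ∷ d ∷ a ∷ b ∷ a ∷ c ∷ e ∷ a ∷ b ∷ []) ∷
    (a ∷ b ∷ d ∷ a ∷ b ∷ a ∷ c ∷ e ∷ a ∷ b ∷ d ∷ f ∷ b ∷ a ∷ c ∷ e ∷ a ∷ b ∷ a ∷ c ∷ b ∷ a ∷ b ∷ d ∷ f ∷ b ∷ a ∷ c ∷ e ∷ a ∷ b ∷ []) ∷
    (a ∷ b ∷ d ∷ f ∷ b ∷ a ∷ b ∷ d ∷ a ∷ b ∷ a ∷ c ∷ b ∷ a ∷ b ∷ d ∷ f ∷ b ∷ a ∷ c ∷ e ∷ a ∷ b ∷ a ∷ c ∷ b ∷ a ∷ b ∷ d ∷ a ∷ b ∷ []) ∷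
    (a ∷ b ∷ d ∷ f ∷ b ∷ a ∷ b ∷ d ∷ a ∷ b ∷ a ∷ c ∷ b ∷ a ∷ b ∷ d ∷ f ∷ b ∷ a ∷ c ∷ e ∷ a ∷ b ∷ d ∷ f ∷ b ∷ a ∷ b ∷ d ∷ a ∷ b ∷ []) ∷
    (a ∷ b ∷ d ∷ f ∷ b ∷ a ∷ b ∷ d ∷ a ∷ b ∷ a ∷ c ∷ e ∷ a ∷ b ∷ d ∷ f ∷ b ∷ a ∷ c ∷ e ∷ a ∷ b ∷ a ∷ c ∷ b ∷ a ∷ b ∷ d ∷ a ∷ b ∷ []) ∷
    (a ∷ b ∷ d ∷ f ∷ b ∷ a ∷ b ∷ d ∷ a ∷ b ∷ a ∷ c ∷ e ∷ a ∷ b ∷ d ∷ f ∷ b ∷ a ∷ c ∷ e ∷ a ∷ b ∷ a ∷ c ∷ b ∷ a ∷ b ∷ d ∷ f ∷ b ∷ []) ∷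
    (a ∷ b ∷ d ∷ f ∷ b ∷ a ∷ c ∷ e ∷ a ∷ b ∷ a ∷ c ∷ b ∷ a ∷ b ∷ d ∷ a ∷ b ∷ a ∷ c ∷ e ∷ a ∷ b ∷ d ∷ f ∷ b ∷ a ∷ b ∷ d ∷ a ∷ b ∷ []) ∷
    (a ∷ b ∷ d ∷ f ∷ b ∷ a ∷ c ∷ e ∷ a ∷ b ∷ a ∷ c ∷ b ∷ a ∷ b ∷ d ∷ a ∷ b ∷ a ∷ c ∷ e ∷ a ∷ b ∷ d ∷ f ∷ b ∷ a ∷ c ∷ e ∷ a ∷ b ∷ []) ∷
    (a ∷ b ∷ d ∷ f ∷ b ∷ a ∷ c ∷ e ∷ a ∷ b ∷ a ∷ c ∷ b ∷ a ∷ b ∷ d ∷ f ∷ b ∷ a ∷ c ∷ e ∷ a ∷ b ∷ d ∷ f ∷ b ∷ a ∷ b ∷ d ∷ a ∷ b ∷ []) ∷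
    (a ∷ b ∷ d ∷ f ∷ b ∷ a ∷ c ∷ e ∷ a ∷ b ∷ d ∷ f ∷ b ∷ a ∷ b ∷ d ∷ a ∷ b ∷ a ∷ c ∷ b ∷ a ∷ b ∷ d ∷ f ∷ b ∷ a ∷ c ∷ e ∷ a ∷ b ∷ []) ∷
    (a ∷ b ∷ d ∷ f ∷ b ∷ a ∷ c ∷ e ∷ a ∷ b ∷ d ∷ f ∷ b ∷ a ∷ b ∷ d ∷ a ∷ b ∷ a ∷ c ∷ e ∷ a ∷ b ∷ d ∷ f ∷ b ∷ a ∷ c ∷ e ∷ a ∷ b ∷ []) ∷
    (a ∷ c ∷ b ∷ a ∷ b ∷ d ∷ a ∷ b ∷ a ∷ c ∷ e ∷ a ∷ b ∷ d ∷ f ∷ b ∷ a ∷ b ∷ d ∷ a ∷ b ∷ a ∷ c ∷ b ∷ a ∷ b ∷ d ∷ f ∷ b ∷ a ∷ c ∷ []) ∷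
    (a ∷ c ∷ b ∷ a ∷ b ∷ d ∷ a ∷ b ∷ a ∷ c ∷ e ∷ a ∷ b ∷ d ∷ f ∷ b ∷ a ∷ c ∷ e ∷ a ∷ b ∷ a ∷ c ∷ b ∷ a ∷ b ∷ d ∷ f ∷ b ∷ a ∷ c ∷ []) ∷
    (a ∷ c ∷ b ∷ a ∷ b ∷ d ∷ f ∷ b ∷ a ∷ c ∷ e ∷ a ∷ b ∷ a ∷ c ∷ b ∷ a ∷ b ∷ d ∷ a ∷ b ∷ a ∷ c ∷ e ∷ a ∷ b ∷ d ∷ f ∷ b ∷ a ∷ b ∷ []) ∷
    (a ∷ c ∷ b ∷ a ∷ b ∷ d ∷ f ∷ b ∷ a ∷ c ∷ e ∷ a ∷ b ∷ a ∷ c ∷ b ∷ a ∷ b ∷ d ∷ a ∷ b ∷ a ∷ c ∷ e ∷ a ∷ b ∷ d ∷ f ∷ b ∷ a ∷ c ∷ []) ∷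
    (a ∷ c ∷ b ∷ a ∷ b ∷ d ∷ f ∷ b ∷ a ∷ c ∷ e ∷ a ∷ b ∷ d ∷ f ∷ b ∷ a ∷ b ∷ d ∷ a ∷ b ∷ a ∷ c ∷ b ∷ a ∷ b ∷ d ∷ f ∷ b ∷ a ∷ c ∷ []) ∷
    (a ∷ c ∷ b ∷ a ∷ b ∷ d ∷ f ∷ b ∷ a ∷ c ∷ e ∷ a ∷ b ∷ d ∷ f ∷ b ∷ a ∷ b ∷ d ∷ a ∷ b ∷ a ∷ c ∷ e ∷ a ∷ b ∷ d ∷ f ∷ b ∷ a ∷ c ∷ []) ∷
    (a ∷ c ∷ e ∷ a ∷ b ∷ a ∷ c ∷ b ∷ a ∷ b ∷ d ∷ a ∷ b ∷ a ∷ c ∷ e ∷ a ∷ b ∷ d ∷ f ∷ b ∷ a ∷ b ∷ d ∷ a ∷ b ∷ a ∷ c ∷ b ∷ a ∷ b ∷ []) ∷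
    (a ∷ c ∷ e ∷ a ∷ b ∷ a ∷ c ∷ b ∷ a ∷ b ∷ d ∷ a ∷ b ∷ a ∷ c ∷ e ∷ a ∷ b ∷ d ∷ f ∷ b ∷ a ∷ c ∷ e ∷ a ∷ b ∷ a ∷ c ∷ b ∷ a ∷ b ∷ []) ∷
    (a ∷ c ∷ e ∷ a ∷ b ∷ a ∷ c ∷ b ∷ a ∷ b ∷ d ∷ f ∷ b ∷ a ∷ c ∷ e ∷ a ∷ b ∷ d ∷ f ∷ b ∷ a ∷ b ∷ d ∷ a ∷ b ∷ a ∷ c ∷ b ∷ a ∷ b ∷ []) ∷
    (a ∷ c ∷ e ∷ a ∷ b ∷ a ∷ c ∷ b ∷ a ∷ b ∷ d ∷ f ∷ b ∷ a ∷ c ∷ e ∷ a ∷ b ∷ d ∷ f ∷ b ∷ a ∷ b ∷ d ∷ a ∷ b ∷ a ∷ c ∷ e ∷ a ∷ b ∷ []) ∷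
    (a ∷ c ∷ e ∷ a ∷ b ∷ d ∷ f ∷ b ∷ a ∷ b ∷ d ∷ a ∷ b ∷ a ∷ c ∷ b ∷ a ∷ b ∷ d ∷ f ∷ b ∷ a ∷ c ∷ e ∷ a ∷ b ∷ a ∷ c ∷ b ∷ a ∷ b ∷ []) ∷
    (a ∷ c ∷ e ∷ a ∷ b ∷ d ∷ f ∷ b ∷ a ∷ b ∷ d ∷ a ∷ b ∷ a ∷ c ∷ b ∷ a ∷ b ∷ d ∷ f ∷ b ∷ a ∷ c ∷ e ∷ a ∷ b ∷ d ∷ f ∷ b ∷ a ∷ b ∷ []) ∷
    (a ∷ c ∷ e ∷ a ∷ b ∷ d ∷ f ∷ b ∷ a ∷ b ∷ d ∷ a ∷ b ∷ a ∷ c ∷ e ∷ a ∷ b ∷ d ∷ f ∷ b ∷ a ∷ c ∷ e ∷ a ∷ b ∷ a ∷ c ∷ b ∷ a ∷ b ∷ []) ∷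
    (a ∷ c ∷ e ∷ a ∷ b ∷ d ∷ f ∷ b ∷ a ∷ c ∷ e ∷ a ∷ b ∷ a ∷ c ∷ b ∷ a ∷ b ∷ d ∷ a ∷ b ∷ a ∷ c ∷ e ∷ a ∷ b ∷ d ∷ f ∷ b ∷ a ∷ b ∷ []) ∷
    (a ∷ c ∷ e ∷ a ∷ b ∷ d ∷ f ∷ b ∷ a ∷ c ∷ e ∷ a ∷ b ∷ a ∷ c ∷ b ∷ a ∷ b ∷ d ∷ f ∷ b ∷ a ∷ c ∷ e ∷ a ∷ b ∷ d ∷ f ∷ b ∷ a ∷ b ∷ []) ∷
    (b ∷ a ∷ b ∷ d ∷ a ∷ b ∷ a ∷ c ∷ b ∷ a ∷ b ∷ d ∷ f ∷ b ∷ a ∷ c ∷ e ∷ a ∷ b ∷ a ∷ c ∷ b ∷ a ∷ b ∷ d ∷ a ∷ b ∷ a ∷ c ∷ e ∷ a ∷ []) ∷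
    (b ∷ a ∷ b ∷ d ∷ a ∷ b ∷ a ∷ c ∷ b ∷ a ∷ b ∷ d ∷ f ∷ b ∷ a ∷ c ∷ e ∷ a ∷ b ∷ d ∷ f ∷ b ∷ a ∷ b ∷ d ∷ a ∷ b ∷ a ∷ c ∷ e ∷ a ∷ []) ∷
    (b ∷ a ∷ b ∷ d ∷ a ∷ b ∷ a ∷ c ∷ e ∷ a ∷ b ∷ d ∷ f ∷ b ∷ a ∷ b ∷ d ∷ a ∷ b ∷ a ∷ c ∷ b ∷ a ∷ b ∷ d ∷ f ∷ b ∷ a ∷ c ∷ e ∷ a ∷ []) ∷
    (b ∷ a ∷ b ∷ d ∷ a ∷ b ∷ a ∷ c ∷ e ∷ a ∷ b ∷ d ∷ f ∷ b ∷ a ∷ c ∷ e ∷ a ∷ b ∷ a ∷ c ∷ b ∷ a ∷ b ∷ d ∷ a ∷ b ∷ a ∷ c ∷ e ∷ a ∷ []) ∷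
    (b ∷ a ∷ b ∷ d ∷ a ∷ b ∷ a ∷ c ∷ e ∷ a ∷ b ∷ d ∷ f ∷ b ∷ a ∷ c ∷ e ∷ a ∷ b ∷ a ∷ c ∷ b ∷ a ∷ b ∷ d ∷ f ∷ b ∷ a ∷ c ∷ e ∷ a ∷ []) ∷
    (b ∷ a ∷ b ∷ d ∷ f ∷ b ∷ a ∷ c ∷ e ∷ a ∷ b ∷ a ∷ c ∷ b ∷ a ∷ b ∷ d ∷ a ∷ b ∷ a ∷ c ∷ e ∷ a ∷ b ∷ d ∷ f ∷ b ∷ a ∷ b ∷ d ∷ a ∷ []) ∷
    (b ∷ a ∷ b ∷ d ∷ f ∷ b ∷ a ∷ c ∷ e ∷ a ∷ b ∷ a ∷ c ∷ b ∷ a ∷ b ∷ d ∷ a ∷ b ∷ a ∷ c ∷ e ∷ a ∷ b ∷ d ∷ f ∷ b ∷ a ∷ c ∷ e ∷ a ∷ []) ∷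
    (b ∷ a ∷ b ∷ d ∷ f ∷ b ∷ a ∷ c ∷ e ∷ a ∷ b ∷ d ∷ f ∷ b ∷ a ∷ b ∷ d ∷ a ∷ b ∷ a ∷ c ∷ b ∷ a ∷ b ∷ d ∷ f ∷ b ∷ a ∷ c ∷ e ∷ a ∷ []) ∷
    (b ∷ a ∷ b ∷ d ∷ f ∷ b ∷ a ∷ c ∷ e ∷ a ∷ b ∷ d ∷ f ∷ b ∷ a ∷ b ∷ d ∷ a ∷ b ∷ a ∷ c ∷ e ∷ a ∷ b ∷ d ∷ f ∷ b ∷ a ∷ c ∷ e ∷ a ∷ []) ∷
    (b ∷ a ∷ c ∷ b ∷ a ∷ b ∷ d ∷ a ∷ b ∷ a ∷ c ∷ e ∷ a ∷ b ∷ d ∷ f ∷ b ∷ a ∷ b ∷ d ∷ a ∷ b ∷ a ∷ c ∷ b ∷ a ∷ b ∷ d ∷ f ∷ b ∷ a ∷ []) ∷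
    (b ∷ a ∷ c ∷ b ∷ a ∷ b ∷ d ∷ a ∷ b ∷ a ∷ c ∷ e ∷ a ∷ b ∷ d ∷ f ∷ b ∷ a ∷ c ∷ e ∷ a ∷ b ∷ a ∷ c ∷ b ∷ a ∷ b ∷ d ∷ f ∷ b ∷ a ∷ []) ∷
    (b ∷ a ∷ c ∷ b ∷ a ∷ b ∷ d ∷ f ∷ b ∷ a ∷ c ∷ e ∷ a ∷ b ∷ a ∷ c ∷ b ∷ a ∷ b ∷ d ∷ a ∷ b ∷ a ∷ c ∷ e ∷ a ∷ b ∷ d ∷ f ∷ b ∷ a ∷ []) ∷
    (b ∷ a ∷ c ∷ b ∷ a ∷ b ∷ d ∷ f ∷ b ∷ a ∷ c ∷ e ∷ a ∷ b ∷ d ∷ f ∷ b ∷ a ∷ b ∷ d ∷ a ∷ b ∷ a ∷ c ∷ b ∷ a ∷ b ∷ d ∷ f ∷ b ∷ a ∷ []) ∷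
    (b ∷ a ∷ c ∷ b ∷ a ∷ b ∷ d ∷ f ∷ b ∷ a ∷ c ∷ e ∷ a ∷ b ∷ d ∷ f ∷ b ∷ a ∷ b ∷ d ∷ a ∷ b ∷ a ∷ c ∷ e ∷ a ∷ b ∷ d ∷ f ∷ b ∷ a ∷ []) ∷
    (b ∷ a ∷ c ∷ e ∷ a ∷ b ∷ a ∷ c ∷ b ∷ a ∷ b ∷ d ∷ a ∷ b ∷ a ∷ c ∷ e ∷ a ∷ b ∷ d ∷ f ∷ b ∷ a ∷ b ∷ d ∷ a ∷ b ∷ a ∷ c ∷ b ∷ a ∷ []) ∷
    (b ∷ a ∷ c ∷ e ∷ a ∷ b ∷ a ∷ c ∷ b ∷ a ∷ b ∷ d ∷ a ∷ b ∷ a ∷ c ∷ e ∷ a ∷ b ∷ d ∷ f ∷ b ∷ a ∷ c ∷ e ∷ a ∷ b ∷ a ∷ c ∷ b ∷ a ∷ []) ∷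
    (b ∷ a ∷ c ∷ e ∷ a ∷ b ∷ a ∷ c ∷ b ∷ a ∷ b ∷ d ∷ f ∷ b ∷ a ∷ c ∷ e ∷ a ∷ b ∷ d ∷ f ∷ b ∷ a ∷ b ∷ d ∷ a ∷ b ∷ a ∷ c ∷ b ∷ a ∷ []) ∷
    (b ∷ a ∷ c ∷ e ∷ a ∷ b ∷ a ∷ c ∷ b ∷ a ∷ b ∷ d ∷ f ∷ b ∷ a ∷ c ∷ e ∷ a ∷ b ∷ d ∷ f ∷ b ∷ a ∷ b ∷ d ∷ a ∷ b ∷ a ∷ c ∷ e ∷ a ∷ []) ∷
    (b ∷ a ∷ c ∷ e ∷ a ∷ b ∷ d ∷ f ∷ b ∷ a ∷ b ∷ d ∷ a ∷ b ∷ a ∷ c ∷ b ∷ a ∷ b ∷ d ∷ f ∷ b ∷ a ∷ c ∷ e ∷ a ∷ b ∷ a ∷ c ∷ b ∷ a ∷ []) ∷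
    (b ∷ a ∷ c ∷ e ∷ a ∷ b ∷ d ∷ f ∷ b ∷ a ∷ b ∷ d ∷ a ∷ b ∷ a ∷ c ∷ b ∷ a ∷ b ∷ d ∷ f ∷ b ∷ a ∷ c ∷ e ∷ a ∷ b ∷ d ∷ f ∷ b ∷ a ∷ []) ∷
    (b ∷ a ∷ c ∷ e ∷ a ∷ b ∷ d ∷ f ∷ b ∷ a ∷ b ∷ d ∷ a ∷ b ∷ a ∷ c ∷ e ∷ a ∷ b ∷ d ∷ f ∷ b ∷ a ∷ c ∷ e ∷ a ∷ b ∷ a ∷ c ∷ b ∷ a ∷ []) ∷
    (b ∷ a ∷ c ∷ e ∷ a ∷ b ∷ d ∷ f ∷ b ∷ a ∷ c ∷ e ∷ a ∷ b ∷ a ∷ c ∷ b ∷ a ∷ b ∷ d ∷ a ∷ b ∷ a ∷ c ∷ e ∷ a ∷ b ∷ d ∷ f ∷ b ∷ a ∷ []) ∷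
    (b ∷ a ∷ c ∷ e ∷ a ∷ b ∷ d ∷ f ∷ b ∷ a ∷ c ∷ e ∷ a ∷ b ∷ a ∷ c ∷ b ∷ a ∷ b ∷ d ∷ f ∷ b ∷ a ∷ c ∷ e ∷ a ∷ b ∷ d ∷ f ∷ b ∷ a ∷ []) ∷
    (b ∷ d ∷ a ∷ b ∷ a ∷ c ∷ b ∷ a ∷ b ∷ d ∷ f ∷ b ∷ a ∷ c ∷ e ∷ a ∷ b ∷ a ∷ c ∷ b ∷ a ∷ b ∷ d ∷ a ∷ b ∷ a ∷ c ∷ e ∷ a ∷ b ∷ d ∷ []) ∷
    (b ∷ d ∷ a ∷ b ∷ a ∷ c ∷ b ∷ a ∷ b ∷ d ∷ f ∷ b ∷ a ∷ c ∷ e ∷ a ∷ b ∷ d ∷ f ∷ b ∷ a ∷ b ∷ d ∷ a ∷ b ∷ a ∷ c ∷ e ∷ a ∷ b ∷ d ∷ []) ∷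
    (b ∷ d ∷ a ∷ b ∷ a ∷ c ∷ e ∷ a ∷ b ∷ d ∷ f ∷ b ∷ a ∷ b ∷ d ∷ a ∷ b ∷ a ∷ c ∷ b ∷ a ∷ b ∷ d ∷ f ∷ b ∷ a ∷ c ∷ e ∷ a ∷ b ∷ a ∷ []) ∷
    (b ∷ d ∷ a ∷ b ∷ a ∷ c ∷ e ∷ a ∷ b ∷ d ∷ f ∷ b ∷ a ∷ b ∷ d ∷ a ∷ b ∷ a ∷ c ∷ b ∷ a ∷ b ∷ d ∷ f ∷ b ∷ a ∷ c ∷ e ∷ a ∷ b ∷ d ∷ []) ∷
    (b ∷ d ∷ a ∷ b ∷ a ∷ c ∷ e ∷ a ∷ b ∷ d ∷ f ∷ b ∷ a ∷ c ∷ e ∷ a ∷ b ∷ a ∷ c ∷ b ∷ a ∷ b ∷ d ∷ a ∷ b ∷ a ∷ c ∷ e ∷ a ∷ b ∷ d ∷ []) ∷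
    (b ∷ d ∷ a ∷ b ∷ a ∷ c ∷ e ∷ a ∷ b ∷ d ∷ f ∷ b ∷ a ∷ c ∷ e ∷ a ∷ b ∷ a ∷ c ∷ b ∷ a ∷ b ∷ d ∷ f ∷ b ∷ a ∷ c ∷ e ∷ a ∷ b ∷ d ∷ []) ∷
    (b ∷ d ∷ f ∷ b ∷ a ∷ b ∷ d ∷ a ∷ b ∷ a ∷ c ∷ b ∷ a ∷ b ∷ d ∷ f ∷ b ∷ a ∷ c ∷ e ∷ a ∷ b ∷ a ∷ c ∷ b ∷ a ∷ b ∷ d ∷ a ∷ b ∷ a ∷ []) ∷
    (b ∷ d ∷ f ∷ b ∷ a ∷ b ∷ d ∷ a ∷ b ∷ a ∷ c ∷ b ∷ a ∷ b ∷ d ∷ f ∷ b ∷ a ∷ c ∷ e ∷ a ∷ b ∷ d ∷ f ∷ b ∷ a ∷ b ∷ d ∷ a ∷ b ∷ a ∷ []) ∷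
    (b ∷ d ∷ f ∷ b ∷ a ∷ b ∷ d ∷ a ∷ b ∷ a ∷ c ∷ e ∷ a ∷ b ∷ d ∷ f ∷ b ∷ a ∷ c ∷ e ∷ a ∷ b ∷ a ∷ c ∷ b ∷ a ∷ b ∷ d ∷ a ∷ b ∷ a ∷ []) ∷
    (b ∷ d ∷ f ∷ b ∷ a ∷ b ∷ d ∷ a ∷ b ∷ a ∷ c ∷ e ∷ a ∷ b ∷ d ∷ f ∷ b ∷ a ∷ c ∷ e ∷ a ∷ b ∷ a ∷ c ∷ b ∷ a ∷ b ∷ d ∷ f ∷ b ∷ a ∷ []) ∷
    (b ∷ d ∷ f ∷ b ∷ a ∷ c ∷ e ∷ a ∷ b ∷ a ∷ c ∷ b ∷ a ∷ b ∷ d ∷ a ∷ b ∷ a ∷ c ∷ e ∷ a ∷ b ∷ d ∷ f ∷ b ∷ a ∷ b ∷ d ∷ a ∷ b ∷ a ∷ []) ∷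
    (b ∷ d ∷ f ∷ b ∷ a ∷ c ∷ e ∷ a ∷ b ∷ a ∷ c ∷ b ∷ a ∷ b ∷ d ∷ a ∷ b ∷ a ∷ c ∷ e ∷ a ∷ b ∷ d ∷ f ∷ b ∷ a ∷ c ∷ e ∷ a ∷ b ∷ a ∷ []) ∷
    (b ∷ d ∷ f ∷ b ∷ a ∷ c ∷ e ∷ a ∷ b ∷ a ∷ c ∷ b ∷ a ∷ b ∷ d ∷ f ∷ b ∷ a ∷ c ∷ e ∷ a ∷ b ∷ d ∷ f ∷ b ∷ a ∷ b ∷ d ∷ a ∷ b ∷ a ∷ []) ∷
    (b ∷ d ∷ f ∷ b ∷ a ∷ c ∷ e ∷ a ∷ b ∷ d ∷ f ∷ b ∷ a ∷ b ∷ d ∷ a ∷ b ∷ a ∷ c ∷ b ∷ a ∷ b ∷ d ∷ f ∷ b ∷ a ∷ c ∷ e ∷ a ∷ b ∷ a ∷ []) ∷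
    (b ∷ d ∷ f ∷ b ∷ a ∷ c ∷ e ∷ a ∷ b ∷ d ∷ f ∷ b ∷ a ∷ b ∷ d ∷ a ∷ b ∷ a ∷ c ∷ e ∷ a ∷ b ∷ d ∷ f ∷ b ∷ a ∷ c ∷ e ∷ a ∷ b ∷ a ∷ []) ∷
    (c ∷ b ∷ a ∷ b ∷ d ∷ a ∷ b ∷ a ∷ c ∷ e ∷ a ∷ b ∷ d ∷ f ∷ b ∷ a ∷ b ∷ d ∷ a ∷ b ∷ a ∷ c ∷ b ∷ a ∷ b ∷ d ∷ f ∷ b ∷ a ∷ c ∷ e ∷ []) ∷
    (c ∷ b ∷ a ∷ b ∷ d ∷ a ∷ b ∷ a ∷ c ∷ e ∷ a ∷ b ∷ d ∷ f ∷ b ∷ a ∷ c ∷ e ∷ a ∷ b ∷ a ∷ c ∷ b ∷ a ∷ b ∷ d ∷ f ∷ b ∷ a ∷ c ∷ e ∷ []) ∷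
    (c ∷ b ∷ a ∷ b ∷ d ∷ f ∷ b ∷ a ∷ c ∷ e ∷ a ∷ b ∷ a ∷ c ∷ b ∷ a ∷ b ∷ d ∷ a ∷ b ∷ a ∷ c ∷ e ∷ a ∷ b ∷ d ∷ f ∷ b ∷ a ∷ b ∷ d ∷ []) ∷
    (c ∷ b ∷ a ∷ b ∷ d ∷ f ∷ b ∷ a ∷ c ∷ e ∷ a ∷ b ∷ a ∷ c ∷ b ∷ a ∷ b ∷ d ∷ a ∷ b ∷ a ∷ c ∷ e ∷ a ∷ b ∷ d ∷ f ∷ b ∷ a ∷ c ∷ e ∷ []) ∷
    (c ∷ b ∷ a ∷ b ∷ d ∷ f ∷ b ∷ a ∷ c ∷ e ∷ a ∷ b ∷ d ∷ f ∷ b ∷ a ∷ b ∷ d ∷ a ∷ b ∷ a ∷ c ∷ b ∷ a ∷ b ∷ d ∷ f ∷ b ∷ a ∷ c ∷ e ∷ []) ∷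
    (c ∷ b ∷ a ∷ b ∷ d ∷ f ∷ b ∷ a ∷ c ∷ e ∷ a ∷ b ∷ d ∷ f ∷ b ∷ a ∷ b ∷ d ∷ a ∷ b ∷ a ∷ c ∷ e ∷ a ∷ b ∷ d ∷ f ∷ b ∷ a ∷ c ∷ e ∷ []) ∷
    (c ∷ e ∷ a ∷ b ∷ a ∷ c ∷ b ∷ a ∷ b ∷ d ∷ a ∷ b ∷ a ∷ c ∷ e ∷ a ∷ b ∷ d ∷ f ∷ b ∷ a ∷ b ∷ d ∷ a ∷ b ∷ a ∷ c ∷ b ∷ a ∷ b ∷ d ∷ []) ∷
    (c ∷ e ∷ a ∷ b ∷ a ∷ c ∷ b ∷ a ∷ b ∷ d ∷ a ∷ b ∷ a ∷ c ∷ e ∷ a ∷ b ∷ d ∷ f ∷ b ∷ a ∷ c ∷ e ∷ a ∷ b ∷ a ∷ c ∷ b ∷ a ∷ b ∷ d ∷ []) ∷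
    (c ∷ e ∷ a ∷ b ∷ a ∷ c ∷ b ∷ a ∷ b ∷ d ∷ f ∷ b ∷ a ∷ c ∷ e ∷ a ∷ b ∷ d ∷ f ∷ b ∷ a ∷ b ∷ d ∷ a ∷ b ∷ a ∷ c ∷ b ∷ a ∷ b ∷ d ∷ []) ∷
    (c ∷ e ∷ a ∷ b ∷ a ∷ c ∷ b ∷ a ∷ b ∷ d ∷ f ∷ b ∷ a ∷ c ∷ e ∷ a ∷ b ∷ d ∷ f ∷ b ∷ a ∷ b ∷ d ∷ a ∷ b ∷ a ∷ c ∷ e ∷ a ∷ b ∷ d ∷ []) ∷
    (c ∷ e ∷ a ∷ b ∷ d ∷ f ∷ b ∷ a ∷ b ∷ d ∷ a ∷ b ∷ a ∷ c ∷ b ∷ a ∷ b ∷ d ∷ f ∷ b ∷ a ∷ c ∷ e ∷ a ∷ b ∷ a ∷ c ∷ b ∷ a ∷ b ∷ d ∷ []) ∷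
    (c ∷ e ∷ a ∷ b ∷ d ∷ f ∷ b ∷ a ∷ b ∷ d ∷ a ∷ b ∷ a ∷ c ∷ b ∷ a ∷ b ∷ d ∷ f ∷ b ∷ a ∷ c ∷ e ∷ a ∷ b ∷ d ∷ f ∷ b ∷ a ∷ b ∷ d ∷ []) ∷
    (c ∷ e ∷ a ∷ b ∷ d ∷ f ∷ b ∷ a ∷ b ∷ d ∷ a ∷ b ∷ a ∷ c ∷ e ∷ a ∷ b ∷ d ∷ f ∷ b ∷ a ∷ c ∷ e ∷ a ∷ b ∷ a ∷ c ∷ b ∷ a ∷ b ∷ d ∷ []) ∷
    (c ∷ e ∷ a ∷ b ∷ d ∷ f ∷ b ∷ a ∷ c ∷ e ∷ a ∷ b ∷ a ∷ c ∷ b ∷ a ∷ b ∷ d ∷ a ∷ b ∷ a ∷ c ∷ e ∷ a ∷ b ∷ d ∷ f ∷ b ∷ a ∷ b ∷ d ∷ []) ∷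
    (c ∷ e ∷ a ∷ b ∷ d ∷ f ∷ b ∷ a ∷ c ∷ e ∷ a ∷ b ∷ a ∷ c ∷ b ∷ a ∷ b ∷ d ∷ f ∷ b ∷ a ∷ c ∷ e ∷ a ∷ b ∷ d ∷ f ∷ b ∷ a ∷ b ∷ d ∷ []) ∷
    (d ∷ a ∷ b ∷ a ∷ c ∷ b ∷ a ∷ b ∷ d ∷ f ∷ b ∷ a ∷ c ∷ e ∷ a ∷ b ∷ a ∷ c ∷ b ∷ a ∷ b ∷ d ∷ a ∷ b ∷ a ∷ c ∷ e ∷ a ∷ b ∷ d ∷ f ∷ []) ∷
    (d ∷ a ∷ b ∷ a ∷ c ∷ b ∷ a ∷ b ∷ d ∷ f ∷ b ∷ a ∷ c ∷ e ∷ a ∷ b ∷ d ∷ f ∷ b ∷ a ∷ b ∷ d ∷ a ∷ b ∷ a ∷ c ∷ e ∷ a ∷ b ∷ d ∷ f ∷ []) ∷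
    (d ∷ a ∷ b ∷ a ∷ c ∷ e ∷ a ∷ b ∷ d ∷ f ∷ b ∷ a ∷ b ∷ d ∷ a ∷ b ∷ a ∷ c ∷ b ∷ a ∷ b ∷ d ∷ f ∷ b ∷ a ∷ c ∷ e ∷ a ∷ b ∷ a ∷ c ∷ []) ∷
    (d ∷ a ∷ b ∷ a ∷ c ∷ e ∷ a ∷ b ∷ d ∷ f ∷ b ∷ a ∷ b ∷ d ∷ a ∷ b ∷ a ∷ c ∷ b ∷ a ∷ b ∷ d ∷ f ∷ b ∷ a ∷ c ∷ e ∷ a ∷ b ∷ d ∷ f ∷ []) ∷
    (d ∷ a ∷ b ∷ a ∷ c ∷ e ∷ a ∷ b ∷ d ∷ f ∷ b ∷ a ∷ c ∷ e ∷ a ∷ b ∷ a ∷ c ∷ b ∷ a ∷ b ∷ d ∷ a ∷ b ∷ a ∷ c ∷ e ∷ a ∷ b ∷ d ∷ f ∷ []) ∷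
    (d ∷ a ∷ b ∷ a ∷ c ∷ e ∷ a ∷ b ∷ d ∷ f ∷ b ∷ a ∷ c ∷ e ∷ a ∷ b ∷ a ∷ c ∷ b ∷ a ∷ b ∷ d ∷ f ∷ b ∷ a ∷ c ∷ e ∷ a ∷ b ∷ d ∷ f ∷ []) ∷
    (d ∷ f ∷ b ∷ a ∷ b ∷ d ∷ a ∷ b ∷ a ∷ c ∷ b ∷ a ∷ b ∷ d ∷ f ∷ b ∷ a ∷ c ∷ e ∷ a ∷ b ∷ a ∷ c ∷ b ∷ a ∷ b ∷ d ∷ a ∷ b ∷ a ∷ c ∷ []) ∷
    (d ∷ f ∷ b ∷ a ∷ b ∷ d ∷ a ∷ b ∷ a ∷ c ∷ b ∷ a ∷ b ∷ d ∷ f ∷ b ∷ a ∷ c ∷ e ∷ a ∷ b ∷ d ∷ f ∷ b ∷ a ∷ b ∷ d ∷ a ∷ b ∷ a ∷ c ∷ []) ∷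
    (d ∷ f ∷ b ∷ a ∷ b ∷ d ∷ a ∷ b ∷ a ∷ c ∷ e ∷ a ∷ b ∷ d ∷ f ∷ b ∷ a ∷ c ∷ e ∷ a ∷ b ∷ a ∷ c ∷ b ∷ a ∷ b ∷ d ∷ a ∷ b ∷ a ∷ c ∷ []) ∷
    (d ∷ f ∷ b ∷ a ∷ b ∷ d ∷ a ∷ b ∷ a ∷ c ∷ e ∷ a ∷ b ∷ d ∷ f ∷ b ∷ a ∷ c ∷ e ∷ a ∷ b ∷ a ∷ c ∷ b ∷ a ∷ b ∷ d ∷ f ∷ b ∷ a ∷ c ∷ []) ∷
    (d ∷ f ∷ b ∷ a ∷ c ∷ e ∷ a ∷ b ∷ a ∷ c ∷ b ∷ a ∷ b ∷ d ∷ a ∷ b ∷ a ∷ c ∷ e ∷ a ∷ b ∷ d ∷ f ∷ b ∷ a ∷ b ∷ d ∷ a ∷ b ∷ a ∷ c ∷ []) ∷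
    (d ∷ f ∷ b ∷ a ∷ c ∷ e ∷ a ∷ b ∷ a ∷ c ∷ b ∷ a ∷ b ∷ d ∷ a ∷ b ∷ a ∷ c ∷ e ∷ a ∷ b ∷ d ∷ f ∷ b ∷ a ∷ c ∷ e ∷ a ∷ b ∷ a ∷ c ∷ []) ∷
    (d ∷ f ∷ b ∷ a ∷ c ∷ e ∷ a ∷ b ∷ a ∷ c ∷ b ∷ a ∷ b ∷ d ∷ f ∷ b ∷ a ∷ c ∷ e ∷ a ∷ b ∷ d ∷ f ∷ b ∷ a ∷ b ∷ d ∷ a ∷ b ∷ a ∷ c ∷ []) ∷
    (d ∷ f ∷ b ∷ a ∷ c ∷ e ∷ a ∷ b ∷ d ∷ f ∷ b ∷ a ∷ b ∷ d ∷ a ∷ b ∷ a ∷ c ∷ b ∷ a ∷ b ∷ d ∷ f ∷ b ∷ a ∷ c ∷ e ∷ a ∷ b ∷ a ∷ c ∷ []) ∷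
    (d ∷ f ∷ b ∷ a ∷ c ∷ e ∷ a ∷ b ∷ d ∷ f ∷ b ∷ a ∷ b ∷ d ∷ a ∷ b ∷ a ∷ c ∷ e ∷ a ∷ b ∷ d ∷ f ∷ b ∷ a ∷ c ∷ e ∷ a ∷ b ∷ a ∷ c ∷ []) ∷
    (e ∷ a ∷ b ∷ a ∷ c ∷ b ∷ a ∷ b ∷ d ∷ a ∷ b ∷ a ∷ c ∷ e ∷ a ∷ b ∷ d ∷ f ∷ b ∷ a ∷ b ∷ d ∷ a ∷ b ∷ a ∷ c ∷ b ∷ a ∷ b ∷ d ∷ f ∷ []) ∷
    (e ∷ a ∷ b ∷ a ∷ c ∷ b ∷ a ∷ b ∷ d ∷ a ∷ b ∷ a ∷ c ∷ e ∷ a ∷ b ∷ d ∷ f ∷ b ∷ a ∷ c ∷ e ∷ a ∷ b ∷ a ∷ c ∷ b ∷ a ∷ b ∷ d ∷ f ∷ []) ∷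
    (e ∷ a ∷ b ∷ a ∷ c ∷ b ∷ a ∷ b ∷ d ∷ f ∷ b ∷ a ∷ c ∷ e ∷ a ∷ b ∷ d ∷ f ∷ b ∷ a ∷ b ∷ d ∷ a ∷ b ∷ a ∷ c ∷ b ∷ a ∷ b ∷ d ∷ f ∷ []) ∷
    (e ∷ a ∷ b ∷ a ∷ c ∷ b ∷ a ∷ b ∷ d ∷ f ∷ b ∷ a ∷ c ∷ e ∷ a ∷ b ∷ d ∷ f ∷ b ∷ a ∷ b ∷ d ∷ a ∷ b ∷ a ∷ c ∷ e ∷ a ∷ b ∷ d ∷ f ∷ []) ∷
    (e ∷ a ∷ b ∷ d ∷ f ∷ b ∷ a ∷ b ∷ d ∷ a ∷ b ∷ a ∷ c ∷ b ∷ a ∷ b ∷ d ∷ f ∷ b ∷ a ∷ c ∷ e ∷ a ∷ b ∷ a ∷ c ∷ b ∷ a ∷ b ∷ d ∷ a ∷ []) ∷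
    (e ∷ a ∷ b ∷ d ∷ f ∷ b ∷ a ∷ b ∷ d ∷ a ∷ b ∷ a ∷ c ∷ b ∷ a ∷ b ∷ d ∷ f ∷ b ∷ a ∷ c ∷ e ∷ a ∷ b ∷ d ∷ f ∷ b ∷ a ∷ b ∷ d ∷ a ∷ []) ∷
    (e ∷ a ∷ b ∷ d ∷ f ∷ b ∷ a ∷ b ∷ d ∷ a ∷ b ∷ a ∷ c ∷ e ∷ a ∷ b ∷ d ∷ f ∷ b ∷ a ∷ c ∷ e ∷ a ∷ b ∷ a ∷ c ∷ b ∷ a ∷ b ∷ d ∷ a ∷ []) ∷
    (e ∷ a ∷ b ∷ d ∷ f ∷ b ∷ a ∷ b ∷ d ∷ a ∷ b ∷ a ∷ c ∷ e ∷ a ∷ b ∷ d ∷ f ∷ b ∷ a ∷ c ∷ e ∷ a ∷ b ∷ a ∷ c ∷ b ∷ a ∷ b ∷ d ∷ f ∷ []) ∷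
    (e ∷ a ∷ b ∷ d ∷ f ∷ b ∷ a ∷ c ∷ e ∷ a ∷ b ∷ a ∷ c ∷ b ∷ a ∷ b ∷ d ∷ a ∷ b ∷ a ∷ c ∷ e ∷ a ∷ b ∷ d ∷ f ∷ b ∷ a ∷ b ∷ d ∷ a ∷ []) ∷
    (e ∷ a ∷ b ∷ d ∷ f ∷ b ∷ a ∷ c ∷ e ∷ a ∷ b ∷ a ∷ c ∷ b ∷ a ∷ b ∷ d ∷ f ∷ b ∷ a ∷ c ∷ e ∷ a ∷ b ∷ d ∷ f ∷ b ∷ a ∷ b ∷ d ∷ a ∷ []) ∷
    (f ∷ b ∷ a ∷ b ∷ d ∷ a ∷ b ∷ a ∷ c ∷ b ∷ a ∷ b ∷ d ∷ f ∷ b ∷ a ∷ c ∷ e ∷ a ∷ b ∷ a ∷ c ∷ b ∷ a ∷ b ∷ d ∷ a ∷ b ∷ a ∷ c ∷ e ∷ []) ∷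
    (f ∷ b ∷ a ∷ b ∷ d ∷ a ∷ b ∷ a ∷ c ∷ b ∷ a ∷ b ∷ d ∷ f ∷ b ∷ a ∷ c ∷ e ∷ a ∷ b ∷ d ∷ f ∷ b ∷ a ∷ b ∷ d ∷ a ∷ b ∷ a ∷ c ∷ e ∷ []) ∷
    (f ∷ b ∷ a ∷ b ∷ d ∷ a ∷ b ∷ a ∷ c ∷ e ∷ a ∷ b ∷ d ∷ f ∷ b ∷ a ∷ c ∷ e ∷ a ∷ b ∷ a ∷ c ∷ b ∷ a ∷ b ∷ d ∷ a ∷ b ∷ a ∷ c ∷ e ∷ []) ∷
    (f ∷ b ∷ a ∷ b ∷ d ∷ a ∷ b ∷ a ∷ c ∷ e ∷ a ∷ b ∷ d ∷ f ∷ b ∷ a ∷ c ∷ e ∷ a ∷ b ∷ a ∷ c ∷ b ∷ a ∷ b ∷ d ∷ f ∷ b ∷ a ∷ c ∷ e ∷ []) ∷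
    (f ∷ b ∷ a ∷ c ∷ e ∷ a ∷ b ∷ a ∷ c ∷ b ∷ a ∷ b ∷ d ∷ a ∷ b ∷ a ∷ c ∷ e ∷ a ∷ b ∷ d ∷ f ∷ b ∷ a ∷ b ∷ d ∷ a ∷ b ∷ a ∷ c ∷ b ∷ []) ∷
    (f ∷ b ∷ a ∷ c ∷ e ∷ a ∷ b ∷ a ∷ c ∷ b ∷ a ∷ b ∷ d ∷ a ∷ b ∷ a ∷ c ∷ e ∷ a ∷ b ∷ d ∷ f ∷ b ∷ a ∷ c ∷ e ∷ a ∷ b ∷ a ∷ c ∷ b ∷ []) ∷
    (f ∷ b ∷ a ∷ c ∷ e ∷ a ∷ b ∷ a ∷ c ∷ b ∷ a ∷ b ∷ d ∷ f ∷ b ∷ a ∷ c ∷ e ∷ a ∷ b ∷ d ∷ f ∷ b ∷ a ∷ b ∷ d ∷ a ∷ b ∷ a ∷ c ∷ b ∷ []) ∷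
    (f ∷ b ∷ a ∷ c ∷ e ∷ a ∷ b ∷ a ∷ c ∷ b ∷ a ∷ b ∷ d ∷ f ∷ b ∷ a ∷ c ∷ e ∷ a ∷ b ∷ d ∷ f ∷ b ∷ a ∷ b ∷ d ∷ a ∷ b ∷ a ∷ c ∷ e ∷ []) ∷
    (f ∷ b ∷ a ∷ c ∷ e ∷ a ∷ b ∷ d ∷ f ∷ b ∷ a ∷ b ∷ d ∷ a ∷ b ∷ a ∷ c ∷ b ∷ a ∷ b ∷ d ∷ f ∷ b ∷ a ∷ c ∷ e ∷ a ∷ b ∷ a ∷ c ∷ b ∷ []) ∷
    (f ∷ b ∷ a ∷ c ∷ e ∷ a ∷ b ∷ d ∷ f ∷ b ∷ a ∷ b ∷ d ∷ a ∷ b ∷ a ∷ c ∷ e ∷ a ∷ b ∷ d ∷ f ∷ b ∷ a ∷ c ∷ e ∷ a ∷ b ∷ a ∷ c ∷ b ∷ []) ∷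
    []

  shortFactors : List Word
  shortFactors =
    [] ∷
    (a ∷ []) ∷
    (b ∷ []) ∷
    (c ∷ []) ∷
    (d ∷ []) ∷
    (e ∷ []) ∷
    (f ∷ []) ∷
    (a ∷ b ∷ []) ∷
    (a ∷ c ∷ []) ∷
    (b ∷ a ∷ []) ∷
    (b ∷ d ∷ []) ∷
    (c ∷ b ∷ []) ∷
    (c ∷ e ∷ []) ∷
    (d ∷ a ∷ []) ∷
    (d ∷ f ∷ []) ∷
    (e ∷ a ∷ []) ∷
    (f ∷ b ∷ []) ∷
    (a ∷ b ∷ a ∷ []) ∷
    (a ∷ b ∷ d ∷ []) ∷
    (a ∷ c ∷ b ∷ []) ∷
    (a ∷ c ∷ e ∷ []) ∷
    (b ∷ a ∷ b ∷ []) ∷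
    (b ∷ a ∷ c ∷ []) ∷
    (b ∷ d ∷ a ∷ []) ∷
    (b ∷ d ∷ f ∷ []) ∷
    (c ∷ b ∷ a ∷ []) ∷
    (c ∷ e ∷ a ∷ []) ∷
    (d ∷ a ∷ b ∷ []) ∷
    (d ∷ f ∷ b ∷ []) ∷
    (e ∷ a ∷ b ∷ []) ∷
    (f ∷ b ∷ a ∷ []) ∷
    []

  factors8 : List Word
  factors8 =
    (a ∷ b ∷ a ∷ c ∷ b ∷ a ∷ b ∷ d ∷ []) ∷
    (a ∷ b ∷ a ∷ c ∷ e ∷ a ∷ b ∷ d ∷ []) ∷
    (a ∷ b ∷ d ∷ a ∷ b ∷ a ∷ c ∷ b ∷ []) ∷
    (a ∷ b ∷ d ∷ a ∷ b ∷ a ∷ c ∷ e ∷ []) ∷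
    (a ∷ b ∷ d ∷ f ∷ b ∷ a ∷ b ∷ d ∷ []) ∷
    (a ∷ b ∷ d ∷ f ∷ b ∷ a ∷ c ∷ e ∷ []) ∷
    (a ∷ c ∷ b ∷ a ∷ b ∷ d ∷ a ∷ b ∷ []) ∷
    (a ∷ c ∷ b ∷ a ∷ b ∷ d ∷ f ∷ b ∷ []) ∷
    (a ∷ c ∷ e ∷ a ∷ b ∷ a ∷ c ∷ b ∷ []) ∷
    (a ∷ c ∷ e ∷ a ∷ b ∷ d ∷ f ∷ b ∷ []) ∷
    (b ∷ a ∷ b ∷ d ∷ a ∷ b ∷ a ∷ c ∷ []) ∷
    (b ∷ a ∷ b ∷ d ∷ f ∷ b ∷ a ∷ c ∷ []) ∷
    (b ∷ a ∷ c ∷ b ∷ a ∷ b ∷ d ∷ a ∷ []) ∷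
    (b ∷ a ∷ c ∷ b ∷ a ∷ b ∷ d ∷ f ∷ []) ∷
    (b ∷ a ∷ c ∷ e ∷ a ∷ b ∷ a ∷ c ∷ []) ∷
    (b ∷ a ∷ c ∷ e ∷ a ∷ b ∷ d ∷ f ∷ []) ∷
    (b ∷ d ∷ a ∷ b ∷ a ∷ c ∷ b ∷ a ∷ []) ∷
    (b ∷ d ∷ a ∷ b ∷ a ∷ c ∷ e ∷ a ∷ []) ∷
    (b ∷ d ∷ f ∷ b ∷ a ∷ b ∷ d ∷ a ∷ []) ∷
    (b ∷ d ∷ f ∷ b ∷ a ∷ c ∷ e ∷ a ∷ []) ∷
    (c ∷ b ∷ a ∷ b ∷ d ∷ a ∷ b ∷ a ∷ []) ∷
    (c ∷ b ∷ a ∷ b ∷ d ∷ f ∷ b ∷ a ∷ []) ∷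
    (c ∷ e ∷ a ∷ b ∷ a ∷ c ∷ b ∷ a ∷ []) ∷
    (c ∷ e ∷ a ∷ b ∷ d ∷ f ∷ b ∷ a ∷ []) ∷
    (d ∷ a ∷ b ∷ a ∷ c ∷ b ∷ a ∷ b ∷ []) ∷
    (d ∷ a ∷ b ∷ a ∷ c ∷ e ∷ a ∷ b ∷ []) ∷
    (d ∷ f ∷ b ∷ a ∷ b ∷ d ∷ a ∷ b ∷ []) ∷
    (d ∷ f ∷ b ∷ a ∷ c ∷ e ∷ a ∷ b ∷ []) ∷
    (e ∷ a ∷ b ∷ a ∷ c ∷ b ∷ a ∷ b ∷ []) ∷
    (e ∷ a ∷ b ∷ d ∷ f ∷ b ∷ a ∷ b ∷ []) ∷
    (e ∷ a ∷ b ∷ d ∷ f ∷ b ∷ a ∷ c ∷ []) ∷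
    (f ∷ b ∷ a ∷ b ∷ d ∷ a ∷ b ∷ a ∷ []) ∷
    (f ∷ b ∷ a ∷ c ∷ e ∷ a ∷ b ∷ a ∷ []) ∷
    (f ∷ b ∷ a ∷ c ∷ e ∷ a ∷ b ∷ d ∷ []) ∷
    []

  contexts : List Context
  contexts =
    ([] , [] , []) ∷
    ((b ∷ []) , (b ∷ []) , (b ∷ [])) ∷
    ((b ∷ []) , (b ∷ []) , (e ∷ [])) ∷
    ((c ∷ []) , (c ∷ []) , (c ∷ [])) ∷
    ((f ∷ []) , (c ∷ []) , (c ∷ [])) ∷
    ((c ∷ []) , (f ∷ []) , []) ∷
    ((f ∷ []) , (f ∷ []) , []) ∷
    ((b ∷ d ∷ []) , (b ∷ d ∷ []) , (b ∷ [])) ∷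
    ((b ∷ d ∷ []) , (b ∷ d ∷ []) , (e ∷ [])) ∷
    ((c ∷ e ∷ []) , (b ∷ d ∷ []) , (b ∷ [])) ∷
    ((c ∷ e ∷ []) , (b ∷ d ∷ []) , (e ∷ [])) ∷
    ((b ∷ d ∷ []) , (c ∷ e ∷ []) , (c ∷ [])) ∷
    ((c ∷ e ∷ []) , (c ∷ e ∷ []) , (c ∷ [])) ∷
    ((a ∷ []) , (a ∷ []) , (a ∷ [])) ∷
    ((a ∷ []) , (a ∷ []) , (f ∷ [])) ∷
    ((d ∷ []) , (d ∷ []) , (d ∷ [])) ∷
    ((e ∷ []) , (d ∷ []) , (d ∷ [])) ∷
    ((d ∷ []) , (e ∷ []) , (b ∷ [])) ∷
    ((d ∷ []) , (e ∷ []) , (e ∷ [])) ∷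
    ((e ∷ []) , (e ∷ []) , (b ∷ [])) ∷
    ((e ∷ []) , (e ∷ []) , (e ∷ [])) ∷
    ((a ∷ c ∷ []) , (a ∷ c ∷ []) , (a ∷ [])) ∷
    ((a ∷ c ∷ []) , (a ∷ c ∷ []) , (f ∷ [])) ∷
    ((d ∷ f ∷ []) , (a ∷ c ∷ []) , (a ∷ [])) ∷
    ((d ∷ f ∷ []) , (a ∷ c ∷ []) , (f ∷ [])) ∷
    ((a ∷ c ∷ []) , (d ∷ f ∷ []) , (d ∷ [])) ∷
    ((d ∷ f ∷ []) , (d ∷ f ∷ []) , (d ∷ [])) ∷
    ((d ∷ []) , (e ∷ []) , []) ∷
    ((e ∷ []) , (e ∷ []) , []) ∷
    ((c ∷ []) , (f ∷ []) , (a ∷ [])) ∷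
    ((c ∷ []) , (f ∷ []) , (f ∷ [])) ∷
    ((f ∷ []) , (f ∷ []) , (a ∷ [])) ∷
    ((f ∷ []) , (f ∷ []) , (f ∷ [])) ∷
    ((c ∷ []) , (c ∷ []) , []) ∷
    ((d ∷ f ∷ []) , (c ∷ []) , []) ∷
    ((c ∷ []) , (d ∷ f ∷ []) , (d ∷ [])) ∷
    ((d ∷ []) , (c ∷ e ∷ []) , (c ∷ [])) ∷
    ((d ∷ []) , (d ∷ []) , []) ∷
    ((c ∷ e ∷ []) , (d ∷ []) , []) ∷
    ((b ∷ []) , (b ∷ []) , (c ∷ [])) ∷
    ((b ∷ d ∷ []) , (b ∷ d ∷ []) , (c ∷ [])) ∷
    ((d ∷ []) , (e ∷ []) , (c ∷ [])) ∷
    ((e ∷ []) , (e ∷ []) , (c ∷ [])) ∷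
    ((c ∷ []) , (a ∷ []) , (a ∷ [])) ∷
    ((f ∷ []) , (a ∷ []) , (a ∷ [])) ∷
    ((a ∷ []) , (c ∷ []) , (c ∷ [])) ∷
    ((a ∷ []) , (f ∷ []) , (f ∷ [])) ∷
    ((d ∷ f ∷ []) , (d ∷ f ∷ []) , []) ∷
    ((d ∷ []) , (b ∷ []) , (b ∷ [])) ∷
    ((e ∷ []) , (b ∷ []) , (b ∷ [])) ∷
    ((b ∷ []) , (d ∷ []) , (d ∷ [])) ∷
    ((b ∷ []) , (e ∷ []) , (e ∷ [])) ∷
    ((a ∷ c ∷ e ∷ []) , (a ∷ c ∷ e ∷ []) , (a ∷ [])) ∷
    ((a ∷ []) , (a ∷ []) , (d ∷ [])) ∷
    ((a ∷ c ∷ []) , (a ∷ c ∷ []) , (d ∷ [])) ∷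
    ((c ∷ []) , (f ∷ []) , (d ∷ [])) ∷
    ((f ∷ []) , (f ∷ []) , (d ∷ [])) ∷
    ((c ∷ []) , (c ∷ []) , (b ∷ [])) ∷
    ((c ∷ []) , (c ∷ []) , (e ∷ [])) ∷
    ((d ∷ f ∷ []) , (c ∷ []) , (b ∷ [])) ∷
    ((d ∷ f ∷ []) , (c ∷ []) , (e ∷ [])) ∷
    ((c ∷ e ∷ []) , (c ∷ e ∷ []) , (b ∷ [])) ∷
    ((c ∷ e ∷ []) , (c ∷ e ∷ []) , (e ∷ [])) ∷
    ((d ∷ f ∷ []) , (c ∷ []) , (c ∷ [])) ∷
    ((b ∷ d ∷ f ∷ []) , (b ∷ d ∷ f ∷ []) , (b ∷ [])) ∷
    ((c ∷ e ∷ []) , (c ∷ e ∷ []) , []) ∷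
    ((d ∷ []) , (d ∷ []) , (a ∷ [])) ∷
    ((d ∷ []) , (d ∷ []) , (f ∷ [])) ∷
    ((c ∷ e ∷ []) , (d ∷ []) , (a ∷ [])) ∷
    ((c ∷ e ∷ []) , (d ∷ []) , (f ∷ [])) ∷
    ((d ∷ f ∷ []) , (d ∷ f ∷ []) , (a ∷ [])) ∷
    ((d ∷ f ∷ []) , (d ∷ f ∷ []) , (f ∷ [])) ∷
    ((c ∷ e ∷ []) , (d ∷ []) , (d ∷ [])) ∷
    []

_≟ʷ_ : DecidableEquality Word
_≟ʷ_ = ≡-dec _≟_

_≟ᶜ_ : DecidableEquality Context
_≟ᶜ_ = Product.≡-dec _≟ʷ_ (Product.≡-dec _≟ʷ_ _≟ʷ_)

open DecMembership _≟ʷ_ using () renaming (_∈?_ to _∈ʷ?_)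
open DecMembership _≟ᶜ_ using () renaming (_∈?_ to _∈ᶜ?_)

windowed : Word → Bool
windowed F = any (isPrefix F) windows

suffixes-windowed : Word → Bool
suffixes-windowed [] = windowed []
suffixes-windowed (x ∷ w) = windowed (take 31 (x ∷ w)) ∧ suffixes-windowed w

shortest-suffix-cover : Word → Word → Bool
shortest-suffix-cover [] t = null t
shortest-suffix-cover (z ∷ u) t = isSuffix t (gʷ (z ∷ u)) ∧ ((length (gʷ (z ∷ u)) ∸ length t) <ᵇ length (g z))

shortest-prefix-cover : Word → Word → Bool
shortest-prefix-cover [] t = null t
shortest-prefix-cover (z ∷ v) t = isPrefix t (gʷ (z ∷ v)) ∧ (length (gʷ (drop-last (z ∷ v))) <ᵇ length t)

marker-at-front : List Marker → Word → Maybe Marker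
marker-at-front [] w = nothing
marker-at-front (i ∷ is) w = if isPrefix (marker-word i) w then just i else marker-at-front is w

find-marker : Word → Maybe (Word × Marker)
find-marker [] = nothing
find-marker (x ∷ w) with marker-at-front markers (x ∷ w)
... | just i = just ([] , i)
... | nothing = Data.Maybe.map (λ (A , i) → (x ∷ A , i)) (find-marker w)

before-cut : Word → Word
before-cut F = maybe (λ (A , i) → A ++ before i) [] (find-marker F)

right-cover-closed : Word → Word → Word → Word → Bool
right-cover-closed u m tR v = implies (shortest-prefix-cover v tR) ⌊ (u , m , v) ∈ᶜ? contexts ⌋

left-cover-closed : Word → Word → Word → Word → Bool
left-cover-closed tL m tR u = implies (shortest-suffix-cover u tL) (all (right-cover-closed u m tR) shortFactors)

covers-closed : Word → Word → Word → Bool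
covers-closed tL m tR = all (left-cover-closed tL m tR) shortFactors

-- Closure of one context (u₁ , u₂ , u₃) for one position W₀ of the marker cut in
-- W: every way of reading the middle S = u₂ W₀ as (suffix s of g x) ++ g(y₂),
-- together with shortest covers u of tL = u₁ W₀ and v of P u₃ (g x = P ++ s),
-- yields a context (u , x y₂ , v) in the list.
middle-word-closed : Word → Word → A₆ → Word → Word → Bool
middle-word-closed tL u₃ x P y₂ = implies (windowed (x ∷ y₂)) (covers-closed tL (x ∷ y₂) (P ++ u₃))

split-closed : Word → Word → Word → A₆ → Word × Word → Bool
split-closed S tL u₃ x (P , s) = maybe (middle-word-closed tL u₃ x P) true (strip s S >>= decode)

letter-closed : Word → Word → Word → A₆ → Bool
letter-closed S tL u₃ x = all (split-closed S tL u₃ x) (proper-splits (g x))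

middle-closed : Word → Word → Word → Bool
middle-closed [] tL u₃ = covers-closed tL [] u₃
middle-closed S@(_ ∷ _) tL u₃ = all (letter-closed S tL u₃) letters

closed-at : Word → Word → Word → Word → Bool
closed-at u₁ u₂ u₃ F = middle-closed (u₂ ++ before-cut F) (u₁ ++ before-cut F) u₃

context-closed : Context → Bool
context-closed (u₁ , u₂ , u₃) = all (closed-at u₁ u₂ u₃) factors8

context-short : Context → Bool
context-short (u₁ , u₂ , u₃) = (length u₁ ≤ᵇ 3) ∧ (length u₃ ≤ᵇ 3) ∧ (length u₁ + length u₂ + length u₃ ≤ᵇ 7)

no-square-of-length : Word → Word → Word → Word → ℕ → Bool
no-square-of-length s u₁ u₂ u₃ n = not (isPrefix (u₁ ++ W ++ u₂ ++ W ++ u₃) s)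
  where
  W : Word
  W = take (suc n) (drop (length u₁) s)

no-short-square : Word → Context → Bool
no-short-square s (u₁ , u₂ , u₃) = all (no-square-of-length s u₁ u₂ u₃) (upTo 12)

window-square-free : Word → Bool
window-square-free s = all (no-short-square s) contexts

image-windowed : Word → Bool
image-windowed s = suffixes-windowed (gʷ s)

prefix-listed : Word → ℕ → Bool
prefix-listed s k = ⌊ take k s ∈ʷ? shortFactors ⌋

short-prefixes-listed : Word → Bool
short-prefixes-listed s = all (prefix-listed s) (upTo 4)

prefix8-listed : Word → Bool
prefix8-listed s = ⌊ take 8 s ∈ʷ? factors8 ⌋

has-marker : Word → Bool
has-marker F = is-just (find-marker F) ∧ (length (before-cut F) ≤ᵇ 8)

opaque
  unfolding windows

  windowed-[] : T (windowed [])
  windowed-[] = _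

  check-a : T (suffixes-windowed (a ∷ []))
  check-a = _

  check-windows : T (all image-windowed windows)
  check-windows = _

  check-shortFactors : T (all short-prefixes-listed windows)
  check-shortFactors = _

  check-factors8 : T (all prefix8-listed windows)
  check-factors8 = _

  check-markers : T (all has-marker factors8)
  check-markers = _

  check-contexts-short : T (all context-short contexts)
  check-contexts-short = _

  check-squares : T ⌊ ([] , [] , []) ∈ᶜ? contexts ⌋
  check-squares = _

  check-no-short-square : T (all window-square-free windows)
  check-no-short-square = _

  check-closed : T (all context-closed contexts)
  check-closed = _

-- Short factors of the iterates are windowed

windowed-sound : ∀ F → T (windowed F) → ∃[ s ] s ∈ windows × ∃[ r ] s ≡ F ++ r
windowed-sound F t with find (any⁻ (isPrefix F) windows t)
... | s , s∈ , pre = s , s∈ , isPrefix-sound F s pre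

windowed-intro : ∀ {s} F r → s ∈ windows → s ≡ F ++ r → T (windowed F)
windowed-intro F r s∈ refl = any⁺ (isPrefix F) (lose s∈ (isPrefix-complete F r))

windowed-prefix : ∀ F R → T (windowed (F ++ R)) → T (windowed F)
windowed-prefix F R t with windowed-sound (F ++ R) t
... | s , s∈ , r , refl = windowed-intro F (R ++ r) s∈ (++-assoc F R r)

Windowed : Word → Set
Windowed X = ∀ U F V → X ≡ U ++ F ++ V → length F ≤ 31 → T (windowed F)

suffixes-windowed-factor : ∀ U F V → T (suffixes-windowed (U ++ F ++ V)) → length F ≤ 31 → T (windowed F)
suffixes-windowed-factor (x ∷ U) F V t lF = suffixes-windowed-factor U F V (proj₂ (∧-split t)) lF
suffixes-windowed-factor [] [] V t lF = windowed-[]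
suffixes-windowed-factor [] (x ∷ F) V t lF with take-prefix 31 (x ∷ F) V lF
... | V′ , eq = windowed-prefix (x ∷ F) V′ (subst (T ∘ windowed) eq (proj₁ (∧-split t)))

factor-of-window-image : ∀ X → Windowed X → ∀ U F V → gʷ X ≡ U ++ F ++ V → length F ≤ 31 →
                         F ≡ [] ⊎ ∃[ s ] s ∈ windows × ∃[ P ] ∃[ V′ ] gʷ s ≡ P ++ F ++ V′
factor-of-window-image X wX U F V eq lF with cut X U (F ++ V) eq
... | cut-at X₁ X₂ P refl refl (at-end _ _ FV≡[]) = inj₁ (++-conicalˡ F V FV≡[])
... | cut-at X₁ X₂ P refl refl (inside z X′ s refl gz≡ s≢[] FV≡) with cover-prefix (z ∷ X′) (P ++ F) V image
  where
  image : gʷ (z ∷ X′) ≡ (P ++ F) ++ V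
  image = begin
    g z ++ gʷ X′         ≡⟨ cong (_++ gʷ X′) gz≡ ⟩
    (P ++ s) ++ gʷ X′    ≡⟨ ++-assoc P s (gʷ X′) ⟩
    P ++ (s ++ gʷ X′)    ≡⟨ cong (P ++_) FV≡ ⟨
    P ++ (F ++ V)        ≡⟨ ++-assoc P F V ⟨
    (P ++ F) ++ V        ∎
    where open ≡-Reasoning
...   | prefix-cover v Y′ R Y≡ gv≡ R≤4 _ with windowed-sound v (wX X₁ v Y′ (cong (X₁ ++_) Y≡) v≤31)
  where
  v≤31 : length v ≤ 31
  v≤31 = short-preimage v 31 refl (s≤s (begin
    length (gʷ v)                 ≡⟨ cong length gv≡ ⟩
    length ((P ++ F) ++ R)        ≡⟨ length-++ (P ++ F) ⟩
    length (P ++ F) + length R    ≡⟨ cong (_+ length R) (length-++ P) ⟩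
    length P + length F + length R ≤⟨ +-mono-≤ (+-mono-≤ (proper-prefix-short z P s gz≡ s≢[]) lF) R≤4 ⟩
    39                            ≤⟨ ≤ᵇ⇒≤ 39 127 _ ⟩
    127                           ∎))
    where open ≤-Reasoning
...     | w , w∈ , r , refl = inj₂ (w , w∈ , P , R ++ gʷ r , image)
  where
  image : gʷ (v ++ r) ≡ P ++ F ++ R ++ gʷ r
  image = trans (gʷ-++ v r) (trans (cong (_++ gʷ r) gv≡)
                (solve 4 (λ P F R G → ((P ⊕ F) ⊕ R) ⊕ G ⊜ P ⊕ F ⊕ R ⊕ G) refl P F R (gʷ r)))

windowed-image : ∀ X → Windowed X → Windowed (gʷ X)
windowed-image X wX U F V eq lF with factor-of-window-image X wX U F V eq lF
... | inj₁ refl = windowed-[]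
... | inj₂ (s , s∈ , P , V′ , gs≡) =
      suffixes-windowed-factor P F V′ (subst (T ∘ suffixes-windowed) gs≡ (all-elim image-windowed s∈ check-windows)) lF

windowed-iterates : ∀ k → Windowed (g^ k (a ∷ []))
windowed-iterates zero U F V eq lF = suffixes-windowed-factor U F V (subst (T ∘ suffixes-windowed) eq check-a) lF
windowed-iterates (suc k) = windowed-image (g^ k (a ∷ [])) (windowed-iterates k)

short-factor : ∀ w → T (windowed w) → length w ≤ 3 → w ∈ shortFactors
short-factor w t w≤3 with windowed-sound w t
... | s , s∈ , r , refl =
      subst (_∈ shortFactors) (take-length-++ w r)
            (toWitness (all-elim (prefix-listed s) (∈-upTo⁺ (s≤s w≤3))
                                 (all-elim short-prefixes-listed s∈ check-shortFactors)))

factor8 : ∀ F → T (windowed F) → length F ≡ 8 → F ∈ factors8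
factor8 F t F≡8 with windowed-sound F t
... | s , s∈ , r , refl =
      subst (_∈ factors8) (trans (cong (λ n → take n (F ++ r)) (sym F≡8)) (take-length-++ F r))
            (toWitness (all-elim prefix8-listed s∈ check-factors8))

shortest-suffix-sound : ∀ u P Z → gʷ u ≡ P ++ Z →
  (u ≡ [] × Z ≡ []) ⊎ (∃[ z ] ∃[ u′ ] u ≡ z ∷ u′ × length P < length (g z)) → T (shortest-suffix-cover u Z)
shortest-suffix-sound u P Z eq (inj₁ (refl , refl)) = _
shortest-suffix-sound u P Z eq (inj₂ (z , u′ , refl , P<gz)) =
  ∧-pair (subst (T ∘ isSuffix Z) (sym eq) (isSuffix-complete P Z)) (<⇒<ᵇ (subst (_< length (g z)) (sym overhang) P<gz))
  where
  overhang : length (gʷ (z ∷ u′)) ∸ length Z ≡ length P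
  overhang = trans (cong (λ w → length w ∸ length Z) eq)
                   (trans (cong (_∸ length Z) (length-++ P)) (m+n∸n≡m (length P) (length Z)))

shortest-prefix-sound : ∀ v Z R → gʷ v ≡ Z ++ R → ShortestPrefix v Z → T (shortest-prefix-cover v Z)
shortest-prefix-sound v Z R eq (empty refl refl) = _
shortest-prefix-sound v Z R eq (last-letter-needed [] z refl lt) =
  ∧-pair (subst (T ∘ isPrefix Z) (sym eq) (isPrefix-complete Z R)) (<⇒<ᵇ lt)
shortest-prefix-sound v Z R eq (last-letter-needed (x ∷ v₀) z refl lt) =
  ∧-pair (subst (T ∘ isPrefix Z) (sym eq) (isPrefix-complete Z R))
         (<⇒<ᵇ (subst (λ w → length (gʷ w) < length Z) (sym (drop-last-snoc (x ∷ v₀) z)) lt))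

covers-closed-elim : ∀ {tL m tR u v} → T (covers-closed tL m tR) →
  u ∈ shortFactors → T (shortest-suffix-cover u tL) → v ∈ shortFactors → T (shortest-prefix-cover v tR) →
  (u , m , v) ∈ contexts
covers-closed-elim {tL} {m} {tR} {u} closed u∈ su v∈ pv =
  toWitness (implies-elim (all-elim (right-cover-closed u m tR) v∈
                                    (implies-elim (all-elim (left-cover-closed tL m tR) u∈ closed) su))
                          pv)

closed-context : ∀ S tL u₃ {m P u v} → T (middle-closed S tL u₃) → Boundary m P S → T (windowed m) →
  u ∈ shortFactors → T (shortest-suffix-cover u tL) → v ∈ shortFactors → T (shortest-prefix-cover v (P ++ u₃)) →
  (u , m , v) ∈ contexts
closed-context S tL u₃ closed (at-end refl refl refl) _ = covers-closed-elim closed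
closed-context S tL u₃ closed (inside x y₂ [] _ _ s≢[] _) _ = ⊥-elim (s≢[] refl)
closed-context S tL u₃ {P = P} closed (inside x y₂ s@(_ ∷ _) refl gx≡ s≢[] refl) m-windowed =
  covers-closed-elim (implies-elim split-ok m-windowed)
  where
  S′ : Word
  S′ = s ++ gʷ y₂
  at-split : T (split-closed S′ tL u₃ x (P , s))
  at-split = all-elim (split-closed S′ tL u₃ x)
                      (subst (λ w → (P , s) ∈ proper-splits w) (sym gx≡) (∈-proper-splits P s s≢[]))
                      (all-elim (letter-closed S′ tL u₃) (∈-letters x) closed)
  split-ok : T (middle-word-closed tL u₃ x P y₂)
  split-ok = subst (T ∘ maybe (middle-word-closed tL u₃ x P) true)
                   (trans (cong (_>>= decode) (strip-++ s (gʷ y₂))) (decode-image y₂))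
                   at-split

-- Squares in context

record Occurs (u₁ u₂ u₃ X : Word) : Set where
  constructor occurs
  field
    U W V : Word
    W≢[] : W ≢ []
    X≡ : X ≡ U ++ u₁ ++ W ++ u₂ ++ W ++ u₃ ++ V

ContextSquare : Word → Set
ContextSquare X = ∃[ u₁ ] ∃[ u₂ ] ∃[ u₃ ] (u₁ , u₂ , u₃) ∈ contexts × Occurs u₁ u₂ u₃ X

-- Listed contexts are short: this bounds the length of short occurrences and
-- of the covers in the desubstitution.
record ShortContext (u₁ u₂ u₃ : Word) : Set where
  field
    u₁≤3 : length u₁ ≤ 3
    u₃≤3 : length u₃ ≤ 3
    sum≤7 : length u₁ + length u₂ + length u₃ ≤ 7

  u₂≤7 : length u₂ ≤ 7
  u₂≤7 = ≤-trans (≤-trans (m≤n+m (length u₂) (length u₁)) (m≤m+n _ (length u₃))) sum≤7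

context-short-sound : ∀ {u₁ u₂ u₃} → (u₁ , u₂ , u₃) ∈ contexts → ShortContext u₁ u₂ u₃
context-short-sound {u₁} {u₂} {u₃} τ∈ with all-elim context-short τ∈ check-contexts-short
... | t with ∧-split {length u₁ ≤ᵇ 3} t
...   | t₁ , t₂₃ with ∧-split {length u₃ ≤ᵇ 3} t₂₃
...     | t₃ , t₇ = record { u₁≤3 = ≤ᵇ⇒≤ _ 3 t₁ ; u₃≤3 = ≤ᵇ⇒≤ _ 3 t₃ ; sum≤7 = ≤ᵇ⇒≤ _ 7 t₇ }

window-without-short-square : ∀ {u₁ u₂ u₃} → (u₁ , u₂ , u₃) ∈ contexts →
  ∀ W r → W ≢ [] → length W ≤ 12 → (u₁ ++ W ++ u₂ ++ W ++ u₃) ++ r ∈ windows → ⊥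
window-without-short-square τ∈ [] r W≢[] _ _ = W≢[] refl
window-without-short-square {u₁} {u₂} {u₃} τ∈ W@(_ ∷ W′) r _ W≤12 s∈ =
  not-T (all-elim (no-square-of-length s u₁ u₂ u₃) (∈-upTo⁺ W≤12)
                  (all-elim (no-short-square s) τ∈ (all-elim window-square-free s∈ check-no-short-square)))
        (subst (λ W → T (isPrefix (u₁ ++ W ++ u₂ ++ W ++ u₃) s)) (sym W-at-|u₁|) (isPrefix-complete I r))
  where
  I s : Word
  I = u₁ ++ W ++ u₂ ++ W ++ u₃
  s = I ++ r
  W-at-|u₁| : take (length W) (drop (length u₁) s) ≡ W
  W-at-|u₁| = begin
    take (length W) (drop (length u₁) ((u₁ ++ W ++ u₂ ++ W ++ u₃) ++ r))  ≡⟨ cong (take (length W) ∘ drop (length u₁)) (++-assoc u₁ _ r) ⟩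
    take (length W) (drop (length u₁) (u₁ ++ (W ++ u₂ ++ W ++ u₃) ++ r))  ≡⟨ cong (take (length W)) (drop-length-++ u₁ _) ⟩
    take (length W) ((W ++ u₂ ++ W ++ u₃) ++ r)                          ≡⟨ cong (take (length W)) (++-assoc W _ r) ⟩
    take (length W) (W ++ (u₂ ++ W ++ u₃) ++ r)                          ≡⟨ take-length-++ W _ ⟩
    W                                                                    ∎
    where open ≡-Reasoning

-- Occurrences with |W| ≤ 12 have length at most 31 and so begin a window.
no-short-occurrence : ∀ X {u₁ u₂ u₃} → (u₁ , u₂ , u₃) ∈ contexts → Windowed X →
                      (o : Occurs u₁ u₂ u₃ X) → length (Occurs.W o) ≤ 12 → ⊥
no-short-occurrence X {u₁} {u₂} {u₃} τ∈ wX (occurs U W V W≢[] X≡) W≤12 with windowed-sound I (wX U I V X≡′ I≤31)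
  where
  I : Word
  I = u₁ ++ W ++ u₂ ++ W ++ u₃
  X≡′ : X ≡ U ++ I ++ V
  X≡′ = trans X≡ (solve 6 (λ U u₁ W u₂ u₃ V → U ⊕ u₁ ⊕ W ⊕ u₂ ⊕ W ⊕ u₃ ⊕ V ⊜ U ⊕ (u₁ ⊕ W ⊕ u₂ ⊕ W ⊕ u₃) ⊕ V)
                       refl U u₁ W u₂ u₃ V)
  lengths : length I ≡ (length u₁ + length u₂ + length u₃) + (length W + length W)
  lengths rewrite length-++ u₁ {W ++ u₂ ++ W ++ u₃} | length-++ W {u₂ ++ W ++ u₃} | length-++ u₂ {W ++ u₃} | length-++ W {u₃} =
    solveℕ 4 (λ p w q r → p :+ (w :+ (q :+ (w :+ r))) := (p :+ q :+ r) :+ (w :+ w)) refl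
           (length u₁) (length W) (length u₂) (length u₃)
  I≤31 : length I ≤ 31
  I≤31 = ≤-trans (≤-reflexive lengths) (+-mono-≤ (ShortContext.sum≤7 (context-short-sound τ∈)) (+-mono-≤ W≤12 W≤12))
... | s , s∈ , r , refl = window-without-short-square τ∈ W r W≢[] W≤12 s∈

-- Pulling long squares back along g

marker-at-front-sound : ∀ is w i → marker-at-front is w ≡ just i → ∃[ r ] w ≡ marker-word i ++ r
marker-at-front-sound (j ∷ is) w i eq with isPrefix (marker-word j) w in pre
... | false = marker-at-front-sound is w i eq
... | true with eq
...   | refl = isPrefix-sound (marker-word j) w (Equivalence.from T-≡ pre)

find-marker-sound : ∀ F A i → find-marker F ≡ just (A , i) → ∃[ r ] F ≡ A ++ marker-word i ++ r
find-marker-sound (x ∷ w) A i eq with marker-at-front markers (x ∷ w) in front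
... | just j with eq
...   | refl = marker-at-front-sound markers (x ∷ w) j front
find-marker-sound (x ∷ w) A i eq | nothing with find-marker w in rest
...   | just (A′ , j) with eq
...     | refl with find-marker-sound w A′ j rest
...       | r , refl = r , refl

record Marked (W : Word) : Set where
  constructor marked
  field
    A B : Word
    i : Marker
    W≡ : W ≡ A ++ marker-word i ++ B
    F∈ : take 8 W ∈ factors8
    cut≡ : before-cut (take 8 W) ≡ A ++ before i
    cut≤8 : length (A ++ before i) ≤ 8

find-marker-in : ∀ W → 8 ≤ length W → take 8 W ∈ factors8 → Marked W
find-marker-in W 8≤W F∈ with find-marker (take 8 W) in found
                           | all-elim has-marker F∈ check-markers
... | just (A , i) | t with find-marker-sound (take 8 W) A i found
...   | r , F≡ = marked A (r ++ drop 8 W) i W≡ F∈ cut≡ (≤ᵇ⇒≤ _ 8 (proj₂ (∧-split t)))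
  where
  cut≡ : before-cut (take 8 W) ≡ A ++ before i
  cut≡ = cong (maybe (λ (A , i) → A ++ before i) []) found
  W≡ : W ≡ A ++ marker-word i ++ r ++ drop 8 W
  W≡ = trans (sym (take++drop≡id 8 W))
             (trans (cong (_++ drop 8 W) F≡) (solve 4 (λ A M r D → (A ⊕ M ⊕ r) ⊕ D ⊜ A ⊕ M ⊕ r ⊕ D) refl A (marker-word i) r (drop 8 W)))

long-factor-marked : ∀ {Z} L W R → Windowed Z → Z ≡ L ++ W ++ R → 13 ≤ length W → Marked W
long-factor-marked L W R wZ Z≡ 13≤W =
  find-marker-in W 8≤W (factor8 (take 8 W) (wZ L (take 8 W) (drop 8 W ++ R) Z≡′ (≤-trans (≤-reflexive F-length) (≤ᵇ⇒≤ 8 31 _))) F-length)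
  where
  8≤W : 8 ≤ length W
  8≤W = ≤-trans (≤ᵇ⇒≤ 8 13 _) 13≤W
  F-length : length (take 8 W) ≡ 8
  F-length = trans (length-take 8 W) (m≤n⇒m⊓n≡m 8≤W)
  Z≡′ : _ ≡ L ++ take 8 W ++ drop 8 W ++ R
  Z≡′ = trans Z≡ (trans (cong (λ w → L ++ w ++ R) (sym (take++drop≡id 8 W))) (cong (L ++_) (++-assoc (take 8 W) (drop 8 W) R)))

record Synchronised (X L M R W₀ W₁ : Word) : Set where
  constructor synchronised
  field
    X₁ y X₃ : Word
    X≡ : X ≡ X₁ ++ y ++ X₃
    left-image : gʷ X₁ ≡ L ++ W₀
    middle-image : gʷ y ≡ W₁ ++ M ++ W₀
    right-image : gʷ X₃ ≡ W₁ ++ R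

-- The two occurrences of the marker inside the two copies of W cut X at the
-- same place relative to W, splitting W = W₀ W₁:  X = X₁ y X₃ with
-- g(X₁) = L W₀,  g(y) = W₁ M W₀,  g(X₃) = W₁ R.
synchronise : ∀ i X L A B M R →
  gʷ X ≡ L ++ (A ++ marker-word i ++ B) ++ M ++ (A ++ marker-word i ++ B) ++ R →
  Synchronised X L M R (A ++ before i) (after i ++ B)
synchronise i X L A B M R eq
  with marker-cut i X (L ++ A) (B ++ M ++ A ++ marker-word i ++ B ++ R)
         (trans eq (solve 7 (λ L A Bi Ai B M R → L ⊕ (A ⊕ (Bi ⊕ Ai) ⊕ B) ⊕ M ⊕ (A ⊕ (Bi ⊕ Ai) ⊕ B) ⊕ R
                                               ⊜ (L ⊕ A) ⊕ (Bi ⊕ Ai) ⊕ (B ⊕ M ⊕ A ⊕ (Bi ⊕ Ai) ⊕ B ⊕ R))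
                             refl L A (before i) (after i) B M R))
... | X₁ , X₂ , refl , g-left , g-rest
  with marker-cut i X₂ (after i ++ B ++ M ++ A) (B ++ R)
         (trans g-rest (solve 7 (λ L A Bi Ai B M R → Ai ⊕ (B ⊕ M ⊕ A ⊕ (Bi ⊕ Ai) ⊕ B ⊕ R)
                                                    ⊜ (Ai ⊕ B ⊕ M ⊕ A) ⊕ (Bi ⊕ Ai) ⊕ (B ⊕ R))
                                 refl L A (before i) (after i) B M R))
...   | y , X₃ , refl , g-middle , g-right =
        synchronised X₁ y X₃ refl
          (trans g-left (++-assoc L A (before i)))
          (trans g-middle (solve 5 (λ Ai B M A Bi → (Ai ⊕ B ⊕ M ⊕ A) ⊕ Bi ⊜ (Ai ⊕ B) ⊕ M ⊕ (A ⊕ Bi)) refl (after i) B M A (before i)))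
          (trans g-right (sym (++-assoc (after i) B R)))

desubstituted-lengths : ∀ {u₁ u₂ u₃} W₀ P Q R u v m → ShortContext u₁ u₂ u₃ → length W₀ ≤ 8 →
  length P ≤ 4 → length Q ≤ 4 → length R ≤ 4 →
  gʷ u ≡ Q ++ u₁ ++ W₀ → gʷ v ≡ (P ++ u₃) ++ R → gʷ m ≡ P ++ u₂ ++ W₀ →
  length u ≤ 3 × length v ≤ 3 × length m ≤ 31
desubstituted-lengths {u₁} {u₂} {u₃} W₀ P Q R u v m sc W₀≤8 P≤4 Q≤4 R≤4 g-u g-v g-m =
  short-preimage u 3 (trans (cong length g-u) (length-++₃ Q u₁ W₀)) (s≤s (+-mono-≤ (+-mono-≤ Q≤4 u₁≤3) W₀≤8)) ,
  short-preimage v 3 (trans (cong length g-v) (trans (length-++ (P ++ u₃)) (cong (_+ length R) (length-++ P))))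
                     (s≤s (≤-trans (+-mono-≤ (+-mono-≤ P≤4 u₃≤3) R≤4) (≤ᵇ⇒≤ 11 15 _))) ,
  short-preimage m 31 (trans (cong length g-m) (length-++₃ P u₂ W₀))
                      (s≤s (≤-trans (+-mono-≤ (+-mono-≤ P≤4 u₂≤7) W₀≤8) (≤ᵇ⇒≤ 19 127 _)))
  where open ShortContext sc

-- Desubstitution of a synchronised square: cutting y = y₁ m after g(y₁) inside
-- W₁, the square u y₁ m y₁ v occurs in X, where u and v are the shortest covers
-- of the outer parts; the closure check places (u , m , v) among the contexts.
desubstitute : ∀ {X u₁ u₂ u₃ U V W₀ W₁} → Windowed X → ShortContext u₁ u₂ u₃ →
  T (middle-closed (u₂ ++ W₀) (u₁ ++ W₀) u₃) → length W₀ ≤ 8 → 5 ≤ length W₁ →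
  Synchronised X (U ++ u₁) u₂ (u₃ ++ V) W₀ W₁ → ContextSquare X
desubstitute {X} {u₁} {u₂} {u₃} {U} {V} {W₀} {W₁} wX sc closed W₀≤8 5≤W₁ (synchronised X₁ y X₃ refl g-left g-middle g-right)
  with cut y W₁ (u₂ ++ W₀) g-middle
... | cut-at y₁ m P refl refl bnd
  with decode-prefix y₁ X₃ (P ++ u₃ ++ V) (trans g-right (++-assoc (gʷ y₁) P (u₃ ++ V)))
... | Y₃ , refl , g-Y₃
  with cover-prefix Y₃ (P ++ u₃) V (trans g-Y₃ (sym (++-assoc P u₃ V)))
     | cover-suffix X₁ U (u₁ ++ W₀) (trans g-left (++-assoc U u₁ W₀))
... | prefix-cover v Y₄ R refl g-v R≤4 v-shortest | suffix-cover X₁′ u Q refl g-u Q≤4 u-shortest =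
  u , m , v , ∈-contexts , occurs X₁′ y₁ Y₄ y₁≢[] X≡
  where
  X≡ : (X₁′ ++ u) ++ (y₁ ++ m) ++ (y₁ ++ (v ++ Y₄)) ≡ X₁′ ++ u ++ y₁ ++ m ++ y₁ ++ v ++ Y₄
  X≡ = solve 6 (λ X u y m v Y → (X ⊕ u) ⊕ (y ⊕ m) ⊕ (y ⊕ (v ⊕ Y)) ⊜ X ⊕ u ⊕ y ⊕ m ⊕ y ⊕ v ⊕ Y) refl X₁′ u y₁ m v Y₄
  y₁≢[] : y₁ ≢ []
  y₁≢[] refl = 1+n≰n (≤-trans 5≤W₁ (boundary-prefix-short bnd))
  lengths : length u ≤ 3 × length v ≤ 3 × length m ≤ 31
  lengths = desubstituted-lengths W₀ P Q R u v m sc W₀≤8 (boundary-prefix-short bnd) Q≤4 R≤4 g-u g-v (boundary-image bnd)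
  u≤3 : length u ≤ 3
  u≤3 = proj₁ lengths
  v≤3 : length v ≤ 3
  v≤3 = proj₁ (proj₂ lengths)
  m-windowed : T (windowed m)
  m-windowed = wX (X₁′ ++ u ++ y₁) m (y₁ ++ v ++ Y₄)
    (trans X≡ (solve 6 (λ X u y m v Y → X ⊕ u ⊕ y ⊕ m ⊕ y ⊕ v ⊕ Y ⊜ (X ⊕ u ⊕ y) ⊕ m ⊕ (y ⊕ v ⊕ Y)) refl X₁′ u y₁ m v Y₄))
    (proj₂ (proj₂ lengths))
  u∈ : u ∈ shortFactors
  u∈ = short-factor u (wX X₁′ u (y₁ ++ m ++ y₁ ++ v ++ Y₄) X≡ (≤-trans u≤3 (≤ᵇ⇒≤ 3 31 _))) u≤3
  v∈ : v ∈ shortFactors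
  v∈ = short-factor v (wX (X₁′ ++ u ++ y₁ ++ m ++ y₁) v Y₄
    (trans X≡ (solve 6 (λ X u y m v Y → X ⊕ u ⊕ y ⊕ m ⊕ y ⊕ v ⊕ Y ⊜ (X ⊕ u ⊕ y ⊕ m ⊕ y) ⊕ v ⊕ Y) refl X₁′ u y₁ m v Y₄))
    (≤-trans v≤3 (≤ᵇ⇒≤ 3 31 _))) v≤3
  ∈-contexts : (u , m , v) ∈ contexts
  ∈-contexts = closed-context (u₂ ++ W₀) (u₁ ++ W₀) u₃ closed bnd m-windowed
                 u∈ (shortest-suffix-sound u Q (u₁ ++ W₀) g-u u-shortest)
                 v∈ (shortest-prefix-sound v (P ++ u₃) R g-v v-shortest)

pull-back : ∀ X {u₁ u₂ u₃} → (u₁ , u₂ , u₃) ∈ contexts → Windowed X → Windowed (gʷ X) →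
            (o : Occurs u₁ u₂ u₃ (gʷ X)) → 13 ≤ length (Occurs.W o) → ContextSquare X
pull-back X {u₁} {u₂} {u₃} τ∈ wX wgX (occurs U W V _ eq) 13≤W
  with long-factor-marked (U ++ u₁) W (u₂ ++ W ++ u₃ ++ V) wgX (trans eq (sym (++-assoc U u₁ _))) 13≤W
... | marked A B i refl F∈ cut≡ cut≤8 =
  desubstitute wX (context-short-sound τ∈) closed cut≤8 5≤W₁ (synchronise i X (U ++ u₁) A B u₂ (u₃ ++ V) eq′)
  where
  Wᵢ : Word
  Wᵢ = A ++ marker-word i ++ B
  eq′ : gʷ X ≡ (U ++ u₁) ++ Wᵢ ++ u₂ ++ Wᵢ ++ u₃ ++ V
  eq′ = trans eq (solve 6 (λ U u₁ W u₂ u₃ V → U ⊕ u₁ ⊕ W ⊕ u₂ ⊕ W ⊕ u₃ ⊕ V ⊜ (U ⊕ u₁) ⊕ W ⊕ u₂ ⊕ W ⊕ u₃ ⊕ V) refl U u₁ Wᵢ u₂ u₃ V)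
  closed : T (middle-closed (u₂ ++ A ++ before i) (u₁ ++ A ++ before i) u₃)
  closed = subst (λ W₀ → T (middle-closed (u₂ ++ W₀) (u₁ ++ W₀) u₃)) cut≡
                 (all-elim (closed-at u₁ u₂ u₃) F∈ (all-elim context-closed τ∈ check-closed))
  W-split : length Wᵢ ≡ length (A ++ before i) + length (after i ++ B)
  W-split = trans (cong length (solve 4 (λ A Bi Ai B → A ⊕ (Bi ⊕ Ai) ⊕ B ⊜ (A ⊕ Bi) ⊕ (Ai ⊕ B)) refl A (before i) (after i) B))
                  (length-++ (A ++ before i))
  5≤W₁ : 5 ≤ length (after i ++ B)
  5≤W₁ = +-cancelˡ-≤ 8 5 _ (≤-trans 13≤W (≤-trans (≤-reflexive W-split) (+-monoˡ-≤ (length (after i ++ B)) cut≤8)))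

no-context-square : ∀ k {u₁ u₂ u₃} → (u₁ , u₂ , u₃) ∈ contexts → Occurs u₁ u₂ u₃ (g^ k (a ∷ [])) → ⊥
no-context-square k τ∈ o with length (Occurs.W o) ≤? 12
... | yes short = no-short-occurrence (g^ k (a ∷ [])) τ∈ (windowed-iterates k) o short
no-context-square zero {u₁} τ∈ (occurs U W V _ eq) | no long
  with ≤-trans (≰⇒> long) (factor-length (U ++ u₁) W _ (trans eq (sym (++-assoc U u₁ _))))
... | s≤s ()
no-context-square (suc k) τ∈ o | no long
  with pull-back (g^ k (a ∷ [])) τ∈ (windowed-iterates k) (windowed-iterates (suc k)) o (≰⇒> long)
... | _ , _ , _ , τ′∈ , o′ = no-context-square k τ′∈ o′

proposition1 : (k : ℕ) (u w v : List A₆) → w ≢ [] →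
               g^ k (a ∷ []) ≡ u ++ (w ++ w) ++ v →
               4 ≤ occ abac (w ++ w) → ⊥
proposition1 k u w v w≢[] eq _ =
  no-context-square k {[]} {[]} {[]} (toWitness {a? = ([] , [] , []) ∈ᶜ? contexts} check-squares) (occurs u w v w≢[] (trans eq (cong (u ++_) (++-assoc w w v))))
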